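{- Let $c$ be an even positive integer and $n\ge1$. Let $d_n^{+(c)}$ (resp. $d_n^{ -(c)}$) be the number of $\pi\in D_n^{(c)}$ with $L(\pi)$ even (resp. odd). Then $$d_n^{+(c)}=\frac{n!}{2}\sum_{k=0}^{n-1}\frac{(-1)^kc^{n-k}}{k!}+(-1)^n,\qquad d_n^{ -(c)}=\frac{n!}{2}\sum_{k=0}^{n-1}\frac{(-1)^kc^{n-k}}{k!},$$ and consequently $d_n^{+(c)}-d_n^{ -(c)}=(-1)^n$.
   Context: $G_{c,n}$ is the set of colored permutations $\pi=\pi_1^{[t_1]}\cdots\pi_n^{[t_n]}$ with $|\pi|=\pi_1\cdots\pi_n$ a permutation of $[n]$ and colors $t_i\in\{0,\dots,c-1\}$; $col(\pi)=\sum_it_i$; $inv(\sigma)$ counts pairs $i<j$ with $\sigma_i>\sigma_j$. The length is $L(\pi)=col(\pi)+c\sum_{j:t_j\ne0}|\{i<j:\pi_i<\pi_j\}|+inv(|\pi|)$. A fixed point of $\pi$ is an index $i$ with $\pi_i=i$ and $t_i=0$; $D_n^{(c)}$ is the set of $\pi\in G_{c,n}$ with no fixed point. -}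

module Defs where

open import Data.Nat as ℕ using (ℕ; zero; suc; _!; _<ᵇ_; _≡ᵇ_)
open import Data.Nat.Properties using (_!≢0)
open import Data.Nat.ListAction using (sum)
open import Data.Fin using (Fin; toℕ)
open import Data.Fin.Properties using () renaming (_≟_ to _≟F_)
open import Data.Bool using (Bool; true; false; _∧_; not; if_then_else_)
open import Data.List using (List; []; _∷_; map; concatMap; length; filter; filterᵇ; allFin; upTo; foldr; cartesianProduct)
open import Data.Vec using (Vec; []; _∷_; lookup; toList)
open import Data.Product using (_×_; _,_; proj₁; proj₂)
open import Data.Integer as ℤ using (ℤ; +_)
open import Data.Rational as ℚ using (ℚ)
open import Relation.Nullary.Decidable using (does)
import Data.List.Relation.Unary.Unique.DecSetoid as UDS
open import Data.Fin.Properties using (≡-decSetoid)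

allVecs : {A : Set} → List A → (n : ℕ) → List (Vec A n)
allVecs xs zero = [] ∷ []
allVecs xs (suc n) = concatMap (λ x → map (x ∷_) (allVecs xs n)) xs

isPermᵇ : {n : ℕ} → Vec (Fin n) n → Bool
isPermᵇ {n} v = does (UDS.unique? (≡-decSetoid n) (toList v))

-- permutations of [n] in one-line notation (entries 0..n-1 stand for 1..n)
Perms : (n : ℕ) → List (Vec (Fin n) n)
Perms n = filterᵇ isPermᵇ (allVecs (allFin n) n)

-- colored permutations G_{c,n}: a permutation |π| together with colors t_i ∈ {0,…,c-1}
ColPerm : ℕ → ℕ → Set
ColPerm c n = Vec (Fin n) n × Vec (Fin c) n

G : (c n : ℕ) → List (ColPerm c n)
G c n = cartesianProduct (Perms n) (allVecs (allFin c) n)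

count : {A : Set} → (A → Bool) → List A → ℕ
count p xs = length (filterᵇ p xs)

_<F_ : {n : ℕ} → Fin n → Fin n → Bool
i <F j = toℕ i <ᵇ toℕ j

col : {c n : ℕ} → ColPerm c n → ℕ
col (σ , t) = sum (map toℕ (toList t))

inv : {n : ℕ} → Vec (Fin n) n → ℕ
inv {n} σ = count (λ ij → (proj₁ ij <F proj₂ ij) ∧ (lookup σ (proj₂ ij) <F lookup σ (proj₁ ij)))
                  (cartesianProduct (allFin n) (allFin n))

colAsc : {c n : ℕ} → ColPerm c n → ℕ
colAsc {c} {n} (σ , t) =
  sum (map (λ j → if toℕ (lookup t j) ≡ᵇ 0 then 0
                  else count (λ i → (i <F j) ∧ (lookup σ i <F lookup σ j)) (allFin n))
           (allFin n))

L : {c n : ℕ} → ColPerm c n → ℕ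
L {c} π = col π ℕ.+ c ℕ.* colAsc π ℕ.+ inv (proj₁ π)

hasFixedPointᵇ : {c n : ℕ} → ColPerm c n → Bool
hasFixedPointᵇ {c} {n} (σ , t) =
  foldr (λ i b → (does (lookup σ i ≟F i) ∧ (toℕ (lookup t i) ≡ᵇ 0)) Data.Bool.∨ b) false (allFin n)

D : (c n : ℕ) → List (ColPerm c n)
D c n = filterᵇ (λ π → not (hasFixedPointᵇ π)) (G c n)

isEvenᵇ : ℕ → Bool
isEvenᵇ m = m ℕ.% 2 ≡ᵇ 0

dPlus : (c n : ℕ) → ℕ
dPlus c n = count (λ π → isEvenᵇ (L π)) (D c n)

dMinus : (c n : ℕ) → ℕ
dMinus c n = count (λ π → not (isEvenᵇ (L π))) (D c n)

sumℚ : List ℚ → ℚ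
sumℚ = foldr ℚ._+_ ℚ.0ℚ

formula : (c n : ℕ) → ℚ
formula c n =
  ((+ (n !)) ℚ./ 2) ℚ.*
  sumℚ (map (λ k → ℚ._/_ (((ℤ.- (+ 1)) ℤ.^ k) ℤ.* ((+ c) ℤ.^ (n ℕ.∸ k))) (k !) {{k !≢0}}) (upTo n))

signℚ : ℕ → ℚ
signℚ n = ((ℤ.- (+ 1)) ℤ.^ n) ℚ./ 1

toℚ : ℕ → ℚ
toℚ m = (+ m) ℚ./ 1

-- Write d⁺ + d⁻ = |D| and d⁺ − d⁻ = ∑_{π ∈ D} (−1)^{L(π)}.  As c is even, c·(…) does not affect the
-- parity of L, so (−1)^{L(π)} = (−1)^{inv |π|} ∏ᵢ (−1)^{tᵢ}.  Summing over the colours first, position i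
-- contributes the signed sum over its admissible colours: 0 if |π|ᵢ ≠ i (all c colours) and −1 if
-- |π|ᵢ = i (colour 0 excluded).  Only the identity survives, so d⁺ − d⁻ = (−1)ⁿ.  In the same way
-- |D| = ∑_σ ∏ᵢ (c − [σᵢ = i]); expanding by the first letter gives an inclusion–exclusion table whose
-- diagonal obeys |D_{n+1}| = (n+1) c |D_n| + (−1)^{n+1}, hence |D_n| = n! ∑_{k ≤ n} (−1)^k c^{n−k}/k!,
-- which is twice the stated sum plus (−1)ⁿ.  Solving for d⁺ and d⁻ gives both formulas.

module Submission where

open import Data.Nat using (ℕ)
open import Relation.Binary.Definitions using (DecidableEquality)

module Sums where

  open import Data.Bool using (Bool; true; false; not; _∨_; if_then_else_)
  open import Data.Fin using (Fin; zero; suc; toℕ)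
  open import Data.Integer using (ℤ; +_; 0ℤ; 1ℤ; _+_; _-_; -_; _*_)
  open import Data.Integer.Properties
    using (+-identityˡ; +-assoc; pos-+; *-zeroˡ; *-zeroʳ; *-comm; *-distribˡ-+; neg-distrib-+)
  open import Data.Integer.Tactic.RingSolver using (solve-∀)
  open import Data.List
    using (List; []; _∷_; map; concatMap; length; filterᵇ; cartesianProduct; _++_; allFin; tabulate)
  open import Data.List.Properties using (map-tabulate; length-tabulate)
  open import Data.Nat as ℕ using (ℕ; zero; suc; _≤_; z≤n; s≤s)
  open import Data.Nat.Properties using (+-comm; +-suc; ≤-reflexive; ≤-trans; n≤1+n)
  open import Data.Product using (_,_)
  open import Data.Vec using (Vec; _∷_)
  open import Function using (_∘_; id)
  open import Relation.Binary.PropositionalEquality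
  open ≡-Reasoning
  open import Defs using (count; allVecs)

  private variable A B : Set

  ∑ : List A → (A → ℤ) → ℤ
  ∑ []       f = 0ℤ
  ∑ (x ∷ xs) f = f x + ∑ xs f

  syntax ∑ xs (λ x → e) = ∑[ x ← xs ] e

  ∑-cong : ∀ (xs : List A) {f g} → (∀ x → f x ≡ g x) → ∑ xs f ≡ ∑ xs g
  ∑-cong []       f≗g = refl
  ∑-cong (x ∷ xs) f≗g = cong₂ _+_ (f≗g x) (∑-cong xs f≗g)

  ∑-++ : ∀ (xs ys : List A) f → ∑ (xs ++ ys) f ≡ ∑ xs f + ∑ ys f
  ∑-++ []       ys f = sym (+-identityˡ _)
  ∑-++ (x ∷ xs) ys f = trans (cong (_+_ (f x)) (∑-++ xs ys f)) (sym (+-assoc (f x) _ _))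

  ∑-map : ∀ (g : A → B) xs f → ∑ (map g xs) f ≡ ∑ xs (f ∘ g)
  ∑-map g []       f = refl
  ∑-map g (x ∷ xs) f = cong (_+_ (f (g x))) (∑-map g xs f)

  ∑-concatMap : ∀ (g : A → List B) xs f → ∑ (concatMap g xs) f ≡ ∑[ x ← xs ] ∑ (g x) f
  ∑-concatMap g []       f = refl
  ∑-concatMap g (x ∷ xs) f =
    trans (∑-++ (g x) (concatMap g xs) f) (cong (_+_ (∑ (g x) f)) (∑-concatMap g xs f))

  ∑-cartesianProduct : ∀ (xs : List A) (ys : List B) f →
    ∑ (cartesianProduct xs ys) f ≡ ∑[ x ← xs ] ∑[ y ← ys ] f (x , y)
  ∑-cartesianProduct []       ys f = refl
  ∑-cartesianProduct (x ∷ xs) ys f =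
    trans (∑-++ (map (x ,_) ys) _ f) (cong₂ _+_ (∑-map (x ,_) ys f) (∑-cartesianProduct xs ys f))

  ∑-filterᵇ : ∀ (p : A → Bool) xs f → ∑ (filterᵇ p xs) f ≡ ∑[ x ← xs ] (if p x then f x else 0ℤ)
  ∑-filterᵇ p []       f = refl
  ∑-filterᵇ p (x ∷ xs) f with p x
  ... | true  = cong (_+_ (f x)) (∑-filterᵇ p xs f)
  ... | false = trans (∑-filterᵇ p xs f) (sym (+-identityˡ _))

  ∑-const-1 : ∀ (xs : List A) → ∑ xs (λ _ → 1ℤ) ≡ + length xs
  ∑-const-1 []       = refl
  ∑-const-1 (x ∷ xs) = trans (cong (_+_ 1ℤ) (∑-const-1 xs)) (sym (pos-+ 1 (length xs)))

  ∑-zero : ∀ (xs : List A) → ∑ xs (λ _ → 0ℤ) ≡ 0ℤ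
  ∑-zero []       = refl
  ∑-zero (x ∷ xs) = trans (+-identityˡ _) (∑-zero xs)

  ∑-distrib-+ : ∀ (xs : List A) f g → ∑[ x ← xs ] (f x + g x) ≡ ∑ xs f + ∑ xs g
  ∑-distrib-+ []       f g = refl
  ∑-distrib-+ (x ∷ xs) f g =
    trans (cong (_+_ (f x + g x)) (∑-distrib-+ xs f g)) (interchange (f x) (g x) (∑ xs f) (∑ xs g))
    where
    interchange : ∀ a b c d → a + b + (c + d) ≡ a + c + (b + d)
    interchange = solve-∀

  ∑-distrib-neg : ∀ (xs : List A) f → ∑[ x ← xs ] (- f x) ≡ - ∑ xs f
  ∑-distrib-neg []       f = refl
  ∑-distrib-neg (x ∷ xs) f = trans (cong (_+_ (- f x)) (∑-distrib-neg xs f)) (sym (neg-distrib-+ (f x) _))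

  ∑-distrib-- : ∀ (xs : List A) f g → ∑[ x ← xs ] (f x - g x) ≡ ∑ xs f - ∑ xs g
  ∑-distrib-- xs f g =
    trans (∑-distrib-+ xs f (λ x → - g x)) (cong (_+_ (∑ xs f)) (∑-distrib-neg xs g))

  ∑-distribˡ-* : ∀ (xs : List A) a f → ∑[ x ← xs ] (a * f x) ≡ a * ∑ xs f
  ∑-distribˡ-* []       a f = sym (*-zeroʳ a)
  ∑-distribˡ-* (x ∷ xs) a f =
    trans (cong (_+_ (a * f x)) (∑-distribˡ-* xs a f)) (sym (*-distribˡ-+ a (f x) _))

  ∑-distribʳ-* : ∀ (xs : List A) a f → ∑[ x ← xs ] (f x * a) ≡ ∑ xs f * a
  ∑-distribʳ-* xs a f = begin
    ∑[ x ← xs ] (f x * a) ≡⟨ ∑-cong xs (λ x → *-comm (f x) a) ⟩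
    ∑[ x ← xs ] (a * f x) ≡⟨ ∑-distribˡ-* xs a f ⟩
    a * ∑ xs f            ≡⟨ *-comm a _ ⟩
    ∑ xs f * a            ∎

  ∑-if : ∀ (p : A → Bool) xs a b →
    ∑[ x ← xs ] (if p x then a else b) ≡ + count p xs * a + + count (not ∘ p) xs * b
  ∑-if p []       a b = refl
  ∑-if p (x ∷ xs) a b with p x
  ... | true  = trans (cong (_+_ a) (∑-if p xs a b)) (count-true a b (+ count p xs) (+ count (not ∘ p) xs))
    where
    count-true : ∀ a b u v → a + (u * a + v * b) ≡ (+ 1 + u) * a + v * b
    count-true = solve-∀
  ... | false = trans (cong (_+_ b) (∑-if p xs a b)) (count-false a b (+ count p xs) (+ count (not ∘ p) xs))
    where
    count-false : ∀ a b u v → b + (u * a + v * b) ≡ u * a + (+ 1 + v) * b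
    count-false = solve-∀

  if0-*ˡ : ∀ b a p → (if b then a * p else 0ℤ) ≡ a * (if b then p else 0ℤ)
  if0-*ˡ true  a p = refl
  if0-*ˡ false a p = sym (*-zeroʳ a)

  if0-*ʳ : ∀ b a p → (if b then a * p else 0ℤ) ≡ (if b then a else 0ℤ) * p
  if0-*ʳ true  a p = refl
  if0-*ʳ false a p = sym (*-zeroˡ p)

  else0-*ˡ : ∀ b a p → (if b then 0ℤ else a * p) ≡ a * (if b then 0ℤ else p)
  else0-*ˡ true  a p = sym (*-zeroʳ a)
  else0-*ˡ false a p = refl

  count-+-count-not : ∀ (p : A → Bool) xs → count p xs ℕ.+ count (not ∘ p) xs ≡ length xs
  count-+-count-not p []       = refl
  count-+-count-not p (x ∷ xs) with p x
  ... | true  = cong suc (count-+-count-not p xs)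
  ... | false = trans (+-suc (count p xs) _) (cong suc (count-+-count-not p xs))

  count-const-false : ∀ (xs : List A) → count (λ _ → false) xs ≡ 0
  count-const-false []       = refl
  count-const-false (_ ∷ xs) = count-const-false xs

  count-const-true : ∀ (xs : List A) → count (λ _ → true) xs ≡ length xs
  count-const-true []       = refl
  count-const-true (_ ∷ xs) = cong suc (count-const-true xs)

  count-cong : ∀ {p q : A → Bool} xs → (∀ x → p x ≡ q x) → count p xs ≡ count q xs
  count-cong []       p≗q = refl
  count-cong {q = q} (x ∷ xs) p≗q rewrite p≗q x with q x
  ... | true  = cong suc (count-cong xs p≗q)
  ... | false = count-cong xs p≗q

  count-+-if : ∀ (p : A → Bool) x xs → count p xs ℕ.+ (if p x then 1 else 0) ≡ count p (x ∷ xs)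
  count-+-if p x xs with p x
  ... | true  = +-comm (count p xs) 1
  ... | false = +-comm (count p xs) 0

  count-∨ : ∀ (p q : A → Bool) xs → count (λ x → p x ∨ q x) xs ≤ count p xs ℕ.+ count q xs
  count-∨ p q []       = z≤n
  count-∨ p q (x ∷ xs) with p x | q x
  ... | true  | true  =
    s≤s (≤-trans (count-∨ p q xs) (≤-trans (n≤1+n _) (≤-reflexive (sym (+-suc (count p xs) _)))))
  ... | true  | false = s≤s (count-∨ p q xs)
  ... | false | true  = ≤-trans (s≤s (count-∨ p q xs)) (≤-reflexive (sym (+-suc (count p xs) _)))
  ... | false | false = count-∨ p q xs

  count≡∑ : ∀ p (xs : List A) → + count p xs ≡ ∑[ x ← xs ] (if p x then 1ℤ else 0ℤ)
  count≡∑ p xs = trans (sym (∑-const-1 (filterᵇ p xs))) (∑-filterᵇ p xs (λ _ → 1ℤ))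

  ∑-allVecs-suc : ∀ (xs : List A) m (f : Vec A (suc m) → ℤ) →
    ∑ (allVecs xs (suc m)) f ≡ ∑[ x ← xs ] ∑[ v ← allVecs xs m ] f (x ∷ v)
  ∑-allVecs-suc xs m f = trans (∑-concatMap (λ x → map (x ∷_) (allVecs xs m)) xs f)
                               (∑-cong xs (λ x → ∑-map (x ∷_) (allVecs xs m) f))

  ∑-allFin-suc : ∀ {k} (f : Fin (suc k) → ℤ) →
    ∑ (allFin (suc k)) f ≡ f zero + ∑[ i ← allFin k ] f (suc i)
  ∑-allFin-suc {k} f = cong (_+_ (f zero)) (begin
    ∑ (tabulate suc) f          ≡⟨ cong (λ xs → ∑ xs f) (map-tabulate id suc) ⟨
    ∑ (map suc (allFin k)) f    ≡⟨ ∑-map suc (allFin k) f ⟩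
    ∑[ i ← allFin k ] f (suc i) ∎)

  ∑-alternating : ∀ q (g : ℕ → ℤ) → (∀ k → g (suc k) ≡ - g k) →
    ∑[ i ← allFin (q ℕ.* 2) ] g (toℕ i) ≡ 0ℤ
  ∑-alternating zero    g alt = refl
  ∑-alternating (suc q) g alt = begin
    ∑[ i ← allFin (suc q ℕ.* 2) ] g (toℕ i)
      ≡⟨ ∑-allFin-suc {suc (q ℕ.* 2)} (g ∘ toℕ) ⟩
    g 0 + ∑[ i ← allFin (suc (q ℕ.* 2)) ] g (suc (toℕ i))
      ≡⟨ cong (_+_ (g 0)) (∑-allFin-suc {q ℕ.* 2} (g ∘ ℕ.suc ∘ toℕ)) ⟩
    g 0 + (g 1 + ∑[ i ← allFin (q ℕ.* 2) ] g (suc (suc (toℕ i))))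
      ≡⟨ cong₂ (λ x y → g 0 + (x + y))
               (alt 0) (∑-alternating q (g ∘ ℕ.suc ∘ ℕ.suc) (alt ∘ ℕ.suc ∘ ℕ.suc)) ⟩
    g 0 + (- g 0 + 0ℤ)
      ≡⟨ cancel (g 0) ⟩
    0ℤ ∎
    where
    cancel : ∀ a → a + (- a + 0ℤ) ≡ 0ℤ
    cancel = solve-∀

  ∑-const-1-allFin : ∀ k → ∑ (allFin k) (λ _ → 1ℤ) ≡ + k
  ∑-const-1-allFin k = trans (∑-const-1 (allFin k)) (cong +_ (length-tabulate {n = k} id))

module Membership {A : Set} (_≟_ : DecidableEquality A) where

  open import Data.Bool using (Bool; true; false; not; _∧_; _∨_; if_then_else_)
  open import Data.Bool.Properties using (∧-conicalˡ; ∨-zeroʳ; ∨-identityʳ; not-injective)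
  open import Data.Empty using (⊥-elim)
  open import Data.Fin using (Fin; zero; suc)
  open import Data.Fin.Properties using (suc-injective; 0≢1+n)
  open import Data.Integer using (ℤ; 0ℤ; _+_)
  open import Data.Integer.Properties using (+-identityˡ; +-identityʳ)
  open import Data.List using (List; []; _∷_; length; filterᵇ; tabulate)
  open import Data.List.Relation.Unary.All using (All; []; _∷_)
  open import Data.List.Relation.Unary.AllPairs using (AllPairs; []; _∷_)
  open import Data.Nat as ℕ using (ℕ; _≤_; z≤n; s≤s)
  open import Data.Nat.Properties using (+-suc; ≤-reflexive; ≤-trans; +-mono-≤)
  open import Function using (_∘_; _⇔_; mk⇔)
  open import Relation.Binary.PropositionalEquality
  open import Relation.Nullary using (yes; no; does; ¬_)
  open ≡-Reasoning
  open import Defs using (count)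
  open Sums

  infix 4 _==_ _∈ᵇ_

  _==_ : A → A → Bool
  x == y = does (x ≟ y)

  ==-refl : ∀ x → (x == x) ≡ true
  ==-refl x with x ≟ x
  ... | yes _  = refl
  ... | no x≢x = ⊥-elim (x≢x refl)

  ==⇒≡ : ∀ {x y} → (x == y) ≡ true → x ≡ y
  ==⇒≡ {x} {y} eq with x ≟ y
  ... | yes x≡y = x≡y

  ≢⇒==-false : ∀ {x y} → ¬ x ≡ y → (x == y) ≡ false
  ≢⇒==-false {x} {y} x≢y with x ≟ y
  ... | yes x≡y = ⊥-elim (x≢y x≡y)
  ... | no _    = refl

  ==-sym : ∀ x y → (x == y) ≡ (y == x)
  ==-sym x y with x ≟ y | y ≟ x
  ... | yes _   | yes _   = refl
  ... | no _    | no _    = refl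
  ... | yes x≡y | no y≢x  = ⊥-elim (y≢x (sym x≡y))
  ... | no x≢y  | yes y≡x = ⊥-elim (x≢y (sym y≡x))

  _∈ᵇ_ : A → List A → Bool
  x ∈ᵇ []     = false
  x ∈ᵇ y ∷ ys = (x == y) ∨ (x ∈ᵇ ys)

  uniqueᵇ : List A → Bool
  uniqueᵇ []       = true
  uniqueᵇ (x ∷ xs) = not (x ∈ᵇ xs) ∧ uniqueᵇ xs

  remove : A → List A → List A
  remove x = filterᵇ (λ y → not (x == y))

  private variable
    x y : A
    xs : List A

  uniqueᵇ-head : ∀ x xs → uniqueᵇ (x ∷ xs) ≡ true → (x ∈ᵇ xs) ≡ false
  uniqueᵇ-head x xs u = not-injective (∧-conicalˡ (not (x ∈ᵇ xs)) _ u)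

  uniqueᵇ-tail : ∀ x xs → uniqueᵇ (x ∷ xs) ≡ true → uniqueᵇ xs ≡ true
  uniqueᵇ-tail x xs u with x ∈ᵇ xs
  ... | false = u

  uniqueᵇ-∷ : ∀ x xs → (x ∈ᵇ xs) ≡ false → uniqueᵇ xs ≡ true → uniqueᵇ (x ∷ xs) ≡ true
  uniqueᵇ-∷ x xs x∉ u rewrite x∉ = u

  ∈ᵇ-remove⁻ : ∀ xs → (y ∈ᵇ remove x xs) ≡ true → (y ∈ᵇ xs) ≡ true
  ∈ᵇ-remove⁻ {y} {x} (z ∷ zs) y∈ with x == z
  ... | true = trans (cong ((y == z) ∨_) (∈ᵇ-remove⁻ zs y∈)) (∨-zeroʳ (y == z))
  ... | false with y == z
  ...   | true  = refl
  ...   | false = ∈ᵇ-remove⁻ zs y∈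

  ∉ᵇ-remove : ∀ xs → (y ∈ᵇ xs) ≡ false → (y ∈ᵇ remove x xs) ≡ false
  ∉ᵇ-remove {y} {x} xs y∉ with y ∈ᵇ remove x xs in eq
  ... | false = refl
  ... | true  = trans (sym (∈ᵇ-remove⁻ xs eq)) y∉

  remove-∉ᵇ : ∀ xs → (x ∈ᵇ xs) ≡ false → remove x xs ≡ xs
  remove-∉ᵇ {x} []       _  = refl
  remove-∉ᵇ {x} (y ∷ ys) x∉ with x == y
  ... | false = cong (y ∷_) (remove-∉ᵇ ys x∉)

  uniqueᵇ-remove : ∀ xs → uniqueᵇ xs ≡ true → uniqueᵇ (remove x xs) ≡ true
  uniqueᵇ-remove {x} []       u = refl
  uniqueᵇ-remove {x} (y ∷ ys) u with x == y
  ... | true  = uniqueᵇ-remove ys (uniqueᵇ-tail y ys u)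
  ... | false = uniqueᵇ-∷ y (remove x ys) (∉ᵇ-remove {x = x} ys (uniqueᵇ-head y ys u))
                                          (uniqueᵇ-remove ys (uniqueᵇ-tail y ys u))

  count-remove : ∀ (p : A → Bool) xs → uniqueᵇ xs ≡ true → (x ∈ᵇ xs) ≡ true →
    count p (remove x xs) ℕ.+ (if p x then 1 else 0) ≡ count p xs
  count-remove {x} p (y ∷ ys) u x∈ with x == y in eq
  ... | true with ==⇒≡ eq
  ...   | refl = trans (cong (λ zs → count p zs ℕ.+ (if p x then 1 else 0))
                             (remove-∉ᵇ ys (uniqueᵇ-head x ys u)))
                       (count-+-if p x ys)
  count-remove {x} p (y ∷ ys) u x∈ | false with p y
  ... | true  = cong ℕ.suc (count-remove p ys (uniqueᵇ-tail y ys u) x∈)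
  ... | false = count-remove p ys (uniqueᵇ-tail y ys u) x∈

  ∑-∉ᵇ : ∀ xs (g : A → ℤ) → (y ∈ᵇ xs) ≡ false →
    ∑[ x ← xs ] (if x == y then g x else 0ℤ) ≡ 0ℤ
  ∑-∉ᵇ {y} []       g y∉ = refl
  ∑-∉ᵇ {y} (x ∷ xs) g y∉ with y == x in eq
  ... | false rewrite ==-sym x y | eq = trans (+-identityˡ _) (∑-∉ᵇ xs g y∉)

  ∑-select : ∀ xs (g : A → ℤ) → uniqueᵇ xs ≡ true →
    ∑[ x ← xs ] (if x == y then g x else 0ℤ) ≡ (if y ∈ᵇ xs then g y else 0ℤ)
  ∑-select {y} []       g u = refl
  ∑-select {y} (x ∷ xs) g u with x == y in eq
  ... | false rewrite ==-sym y x | eq = trans (+-identityˡ _) (∑-select xs g (uniqueᵇ-tail x xs u))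
  ... | true with ==⇒≡ eq
  ...   | refl rewrite ==-refl x =
          trans (cong (_+_ (g x)) (∑-∉ᵇ xs g (uniqueᵇ-head x xs u))) (+-identityʳ _)

  ∑-cong-∈ᵇ : ∀ xs {f g : A → ℤ} → (∀ x → (x ∈ᵇ xs) ≡ true → f x ≡ g x) →
    ∑ xs f ≡ ∑ xs g
  ∑-cong-∈ᵇ []       f≗g = refl
  ∑-cong-∈ᵇ (x ∷ xs) f≗g =
    cong₂ _+_ (f≗g x (cong (_∨ (x ∈ᵇ xs)) (==-refl x)))
              (∑-cong-∈ᵇ xs (λ y y∈ → f≗g y (trans (cong ((y == x) ∨_) y∈) (∨-zeroʳ (y == x)))))

  count-==-∨-∉ᵇ : ∀ (p : A → Bool) xs → (y ∈ᵇ xs) ≡ false →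
    count (λ z → (z == y) ∨ p z) xs ≡ count p xs
  count-==-∨-∉ᵇ {y} p []       y∉ = refl
  count-==-∨-∉ᵇ {y} p (z ∷ zs) y∉ with y == z in eq
  ... | false rewrite ==-sym z y | eq with p z
  ...   | true  = cong ℕ.suc (count-==-∨-∉ᵇ p zs y∉)
  ...   | false = count-==-∨-∉ᵇ p zs y∉

  count-==-∨ : ∀ (p : A → Bool) xs → uniqueᵇ xs ≡ true → p y ≡ false →
    count (λ z → (z == y) ∨ p z) xs ≡ (if y ∈ᵇ xs then 1 else 0) ℕ.+ count p xs
  count-==-∨ {y} p []       u py = refl
  count-==-∨ {y} p (z ∷ zs) u py with z == y in eq
  ... | true with ==⇒≡ eq
  ...   | refl rewrite ==-refl z | py = cong ℕ.suc (count-==-∨-∉ᵇ p zs (uniqueᵇ-head z zs u))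
  count-==-∨ {y} p (z ∷ zs) u py | false rewrite ==-sym y z | eq with p z
  ... | true  = trans (cong ℕ.suc (count-==-∨ p zs (uniqueᵇ-tail z zs u) py)) (sym (+-suc _ (count p zs)))
  ... | false = count-==-∨ p zs (uniqueᵇ-tail z zs u) py

  count-==-≤1 : ∀ xs → uniqueᵇ xs ≡ true → count (_== y) xs ≤ 1
  count-==-≤1 {y} []       u = z≤n
  count-==-≤1 {y} (z ∷ zs) u with z == y in eq
  ... | false = count-==-≤1 zs (uniqueᵇ-tail z zs u)
  ... | true with ==⇒≡ eq
  ...   | refl = s≤s (≤-reflexive (begin
          count (_== z) zs                        ≡⟨ count-cong zs (λ w → sym (∨-identityʳ (w == z))) ⟩
          count (λ w → (w == z) ∨ false) zs
            ≡⟨ count-==-∨-∉ᵇ (λ _ → false) zs (uniqueᵇ-head z zs u) ⟩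
          count (λ _ → false) zs                  ≡⟨ count-const-false zs ⟩
          0                                       ∎))

  pigeonhole : ∀ ks xs → uniqueᵇ xs ≡ true → count (_∈ᵇ ks) xs ≤ length ks
  pigeonhole []       xs u = ≤-reflexive (count-const-false xs)
  pigeonhole (k ∷ ks) xs u =
    ≤-trans (count-∨ (_== k) (_∈ᵇ ks) xs) (+-mono-≤ (count-==-≤1 xs u) (pigeonhole ks xs u))

  ∈ᵇ-tabulate : ∀ {m} (f : Fin m → A) i → (f i ∈ᵇ tabulate f) ≡ true
  ∈ᵇ-tabulate f zero    rewrite ==-refl (f zero) = refl
  ∈ᵇ-tabulate f (suc i) = trans (cong ((f (suc i) == f zero) ∨_) (∈ᵇ-tabulate (f ∘ suc) i)) (∨-zeroʳ _)

  ∉ᵇ-tabulate : ∀ {m} (f : Fin m → A) → (∀ i → ¬ y ≡ f i) → (y ∈ᵇ tabulate f) ≡ false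
  ∉ᵇ-tabulate {m = ℕ.zero}  f y∉ = refl
  ∉ᵇ-tabulate {m = ℕ.suc m} f y∉ rewrite ≢⇒==-false (y∉ zero) = ∉ᵇ-tabulate (f ∘ suc) (y∉ ∘ suc)

  uniqueᵇ-tabulate : ∀ {m} (f : Fin m → A) → (∀ {i j} → f i ≡ f j → i ≡ j) →
    uniqueᵇ (tabulate f) ≡ true
  uniqueᵇ-tabulate {m = ℕ.zero}  f inj = refl
  uniqueᵇ-tabulate {m = ℕ.suc m} f inj
    rewrite ∉ᵇ-tabulate (f ∘ suc) (λ i f0≡fi → 0≢1+n (inj f0≡fi)) =
    uniqueᵇ-tabulate (f ∘ suc) (λ fi≡fj → suc-injective (inj fi≡fj))

  length-remove : ∀ xs → uniqueᵇ xs ≡ true → (x ∈ᵇ xs) ≡ true →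
    length (remove x xs) ℕ.+ 1 ≡ length xs
  length-remove {x} xs u x∈ = begin
    length (remove x xs) ℕ.+ 1            ≡⟨ cong (ℕ._+ 1) (count-const-true (remove x xs)) ⟨
    count (λ _ → true) (remove x xs) ℕ.+ 1 ≡⟨ count-remove (λ _ → true) xs u x∈ ⟩
    count (λ _ → true) xs                 ≡⟨ count-const-true xs ⟩
    length xs                             ∎

  ∉ᵇ⇒All≢ : ∀ xs → (x ∈ᵇ xs) ≡ false → All (λ y → ¬ x ≡ y) xs
  ∉ᵇ⇒All≢ {x} []       x∉ = []
  ∉ᵇ⇒All≢ {x} (y ∷ ys) x∉ with x ≟ y
  ... | no x≢y = x≢y ∷ ∉ᵇ⇒All≢ ys x∉

  All≢⇒∉ᵇ : ∀ xs → All (λ y → ¬ x ≡ y) xs → (x ∈ᵇ xs) ≡ false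
  All≢⇒∉ᵇ []       []           = refl
  All≢⇒∉ᵇ (y ∷ ys) (x≢y ∷ x≢ys) rewrite ≢⇒==-false x≢y = All≢⇒∉ᵇ ys x≢ys

  uniqueᵇ⇔AllPairs≢ : ∀ xs → uniqueᵇ xs ≡ true ⇔ AllPairs (λ x y → ¬ x ≡ y) xs
  uniqueᵇ⇔AllPairs≢ xs = mk⇔ (to xs) (from xs)
    where
    to : ∀ xs → uniqueᵇ xs ≡ true → AllPairs (λ x y → ¬ x ≡ y) xs
    to []       u = []
    to (x ∷ xs) u = ∉ᵇ⇒All≢ xs (uniqueᵇ-head x xs u) ∷ to xs (uniqueᵇ-tail x xs u)
    from : ∀ xs → AllPairs (λ x y → ¬ x ≡ y) xs → uniqueᵇ xs ≡ true
    from []       []             = refl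
    from (x ∷ xs) (x≢xs ∷ pairs) = uniqueᵇ-∷ x xs (All≢⇒∉ᵇ xs x≢xs) (from xs pairs)

module Words {A : Set} (_≟_ : DecidableEquality A) where

  open import Data.Bool using (true; false; not; _∨_; if_then_else_)
  open import Data.Bool.Properties using (if-not; if-∧)
  open import Data.Integer using (ℤ; 0ℤ)
  open import Data.Nat using (zero; suc)
  open import Data.Vec using (Vec; _∷_; toList)
  open import Relation.Binary.PropositionalEquality
  open ≡-Reasoning
  open import Defs using (allVecs)
  open Sums
  open Membership _≟_

  ∑-allVecs-avoiding : ∀ m xs x (g : Vec A m → ℤ) →
    ∑[ w ← allVecs xs m ] (if x ∈ᵇ toList w then 0ℤ else g w) ≡ ∑ (allVecs (remove x xs) m) g
  ∑-allVecs-avoiding zero    xs x g = refl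
  ∑-allVecs-avoiding (suc m) xs x g = begin
    ∑[ w ← allVecs xs (suc m) ] (if x ∈ᵇ toList w then 0ℤ else g w)
      ≡⟨ ∑-allVecs-suc xs m _ ⟩
    ∑[ y ← xs ] ∑[ w ← allVecs xs m ] (if (x == y) ∨ (x ∈ᵇ toList w) then 0ℤ else g (y ∷ w))
      ≡⟨ ∑-cong xs first-letter ⟩
    ∑[ y ← xs ] (if x == y then 0ℤ else ∑[ w ← allVecs (remove x xs) m ] g (y ∷ w))
      ≡⟨ ∑-cong xs (λ y → sym (if-not (x == y))) ⟩
    ∑[ y ← xs ] (if not (x == y) then ∑[ w ← allVecs (remove x xs) m ] g (y ∷ w) else 0ℤ)
      ≡⟨ ∑-filterᵇ _ xs _ ⟨
    ∑[ y ← remove x xs ] ∑[ w ← allVecs (remove x xs) m ] g (y ∷ w)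
      ≡⟨ ∑-allVecs-suc (remove x xs) m g ⟨
    ∑ (allVecs (remove x xs) (suc m)) g ∎
    where
    first-letter : ∀ y →
      ∑[ w ← allVecs xs m ] (if (x == y) ∨ (x ∈ᵇ toList w) then 0ℤ else g (y ∷ w))
      ≡ (if x == y then 0ℤ else ∑[ w ← allVecs (remove x xs) m ] g (y ∷ w))
    first-letter y with x == y
    ... | true  = ∑-zero (allVecs xs m)
    ... | false = ∑-allVecs-avoiding m xs x (λ w → g (y ∷ w))

  ∑-uniqueWords-suc : ∀ m xs (f : Vec A (suc m) → ℤ) →
    ∑[ v ← allVecs xs (suc m) ] (if uniqueᵇ (toList v) then f v else 0ℤ)
    ≡ ∑[ x ← xs ] ∑[ w ← allVecs (remove x xs) m ] (if uniqueᵇ (toList w) then f (x ∷ w) else 0ℤ)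
  ∑-uniqueWords-suc m xs f = trans (∑-allVecs-suc xs m _) (∑-cong xs (λ x →
    trans (∑-cong (allVecs xs m) (λ w →
             trans (if-∧ (not (x ∈ᵇ toList w))) (if-not (x ∈ᵇ toList w))))
          (∑-allVecs-avoiding m xs x (λ w → if uniqueᵇ (toList w) then f (x ∷ w) else 0ℤ))))

module Signs where

  open import Data.Bool using (not; if_then_else_)
  open import Data.Integer using (ℤ; +_; 0ℤ; 1ℤ; -1ℤ; _-_; -_; _*_; _^_)
  open import Data.Integer.Properties using (*-identityˡ; *-assoc; -1*i≡-i)
  open import Data.Integer.Tactic.RingSolver using (solve-∀)
  open import Data.Nat as ℕ using (ℕ; zero; suc; _%_; _≡ᵇ_)
  open import Data.Nat.DivMod using ([m+n]%n≡m%n)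
  open import Data.Nat.Properties using (+-comm)
  import Data.Nat.Tactic.RingSolver as ℕ-Solver
  open import Function using (_∘_)
  open import Relation.Binary.PropositionalEquality
  open ≡-Reasoning
  open import Defs using (isEvenᵇ; count)
  open Sums

  ε : ℕ → ℤ
  ε m = -1ℤ ^ m

  ε-suc : ∀ m → ε (suc m) ≡ - ε m
  ε-suc m = -1*i≡-i (ε m)

  ε-+ : ∀ a b → ε (a ℕ.+ b) ≡ ε a * ε b
  ε-+ zero    b = sym (*-identityˡ (ε b))
  ε-+ (suc a) b = trans (cong (-1ℤ *_) (ε-+ a b)) (sym (*-assoc -1ℤ (ε a) (ε b)))

  ε-square : ∀ a → ε a * ε a ≡ 1ℤ
  ε-square zero    = refl
  ε-square (suc a) = trans (square (ε a)) (ε-square a)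
    where
    square : ∀ e → (-1ℤ * e) * (-1ℤ * e) ≡ e * e
    square = solve-∀

  ε-*-even : ∀ q x → ε (q ℕ.* 2 ℕ.* x) ≡ 1ℤ
  ε-*-even q x = begin
    ε (q ℕ.* 2 ℕ.* x)            ≡⟨ cong ε (double q x) ⟩
    ε (q ℕ.* x ℕ.+ q ℕ.* x)      ≡⟨ ε-+ (q ℕ.* x) (q ℕ.* x) ⟩
    ε (q ℕ.* x) * ε (q ℕ.* x)    ≡⟨ ε-square (q ℕ.* x) ⟩
    1ℤ                            ∎
    where
    double : ∀ q x → q ℕ.* 2 ℕ.* x ≡ q ℕ.* x ℕ.+ q ℕ.* x
    double = ℕ-Solver.solve-∀

  isEven-suc-suc : ∀ m → isEvenᵇ (suc (suc m)) ≡ isEvenᵇ m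
  isEven-suc-suc m = cong (_≡ᵇ 0) (trans (cong (_% 2) (+-comm 2 m)) ([m+n]%n≡m%n m 2))

  even-indicator-difference : ∀ m →
    (if isEvenᵇ m then 1ℤ else 0ℤ) - (if not (isEvenᵇ m) then 1ℤ else 0ℤ) ≡ ε m
  even-indicator-difference zero          = refl
  even-indicator-difference (suc zero)    = refl
  even-indicator-difference (suc (suc m)) rewrite isEven-suc-suc m =
    trans (even-indicator-difference m) (sym (-1*-1* (ε m)))
    where
    -1*-1* : ∀ e → -1ℤ * (-1ℤ * e) ≡ e
    -1*-1* = solve-∀

  count-even-−-count-odd : ∀ {A : Set} (f : A → ℕ) xs →
    + count (isEvenᵇ ∘ f) xs - + count (not ∘ isEvenᵇ ∘ f) xs ≡ ∑[ x ← xs ] ε (f x)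
  count-even-−-count-odd f xs = begin
    + count (isEvenᵇ ∘ f) xs - + count (not ∘ isEvenᵇ ∘ f) xs
      ≡⟨ cong₂ _-_ (count≡∑ (isEvenᵇ ∘ f) xs) (count≡∑ (not ∘ isEvenᵇ ∘ f) xs) ⟩
    ∑[ x ← xs ] (if isEvenᵇ (f x) then 1ℤ else 0ℤ)
      - ∑[ x ← xs ] (if not (isEvenᵇ (f x)) then 1ℤ else 0ℤ)
      ≡⟨ ∑-distrib-- xs _ _ ⟨
    ∑[ x ← xs ] ((if isEvenᵇ (f x) then 1ℤ else 0ℤ) - (if not (isEvenᵇ (f x)) then 1ℤ else 0ℤ))
      ≡⟨ ∑-cong xs (even-indicator-difference ∘ f) ⟩
    ∑[ x ← xs ] ε (f x) ∎

module ArrangementNumbers (c : ℕ) where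

  open import Data.Bool using (Bool; true; false; if_then_else_)
  open import Data.Integer using (ℤ; +_; 0ℤ; -1ℤ; _+_; _-_; _*_; _^_)
  open import Data.Integer.Properties using (+-identityʳ; +-inverseʳ; *-zeroʳ; *-zeroˡ; pos-*)
  open import Data.Integer.Tactic.RingSolver using (solve-∀)
  open import Data.Nat as ℕ using (ℕ; zero; suc; _≤_; s≤s; z≤n; _∸_; _!)
  open import Data.Nat.Properties using (+-suc; suc-injective; +-comm; m≤n⇒m≤1+n; ≤-refl)
  open import Relation.Binary.PropositionalEquality
  open ≡-Reasoning
  open Signs

  private
    +-cancel-difference : ∀ {x y a b} → x ≡ y + (a - b) → a ≡ b → x ≡ y
    +-cancel-difference {y = y} {b = b} x≡ refl =
      trans x≡ (trans (cong (_+_ y) (+-inverseʳ b)) (+-identityʳ y))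

  -- For k ≤ m, Q m k = ∑ⱼ (−1)ʲ C(k,j) (m−j)! c^(m−j) is the sum, over the arrangements of m letters
  -- of which k own a slot, of ∏ (c − [letter in its own slot]) (see ∑-arrangements).
  Q : ℕ → ℕ → ℤ
  Q m       zero    = + (m !) * (+ c) ^ m
  Q zero    (suc k) = 0ℤ
  Q (suc m) (suc k) = Q (suc m) k - Q m k

  Q-unfold : ∀ m k → + c * + k * Q (suc m) (k ∸ 1) ≡ + c * + k * (Q (suc m) k + Q m (k ∸ 1))
  Q-unfold m zero    = trans (c*0* (Q (suc m) 0)) (sym (c*0* (Q (suc m) 0 + Q m 0)))
    where
    c*0* : ∀ x → + c * + 0 * x ≡ 0ℤ
    c*0* x = trans (cong (_* x) (*-zeroʳ (+ c))) (*-zeroˡ x)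
  Q-unfold m (suc k) = cong (λ x → + c * + suc k * x) (sym (m-n+n (Q (suc m) k) (Q m k)))
    where
    m-n+n : ∀ x y → x - y + y ≡ x
    m-n+n = solve-∀

  Q-suc : ∀ m k j → k ℕ.+ j ≡ suc m → k ≤ m →
    Q (suc m) k ≡ + c * + k * Q m (k ∸ 1) + + c * + j * Q m k
  Q-suc m zero .(suc m) refl z≤n = begin
    + (suc m ℕ.* m !) * (+ c * (+ c) ^ m)        ≡⟨ cong (_* (+ c * (+ c) ^ m)) (pos-* (suc m) (m !)) ⟩
    + suc m * + (m !) * (+ c * (+ c) ^ m)        ≡⟨ rearrange (+ c) (+ suc m) (+ (m !)) ((+ c) ^ m) ⟩
    + c * + 0 * Q m 0 + + c * + suc m * Q m 0  ∎
    where
    rearrange : ∀ c s f p → s * f * (c * p) ≡ c * + 0 * (f * p) + c * s * (f * p)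
    rearrange = solve-∀
  Q-suc (suc m) (suc k) j eq (s≤s k≤m) = begin
      Q (suc (suc m)) k - Q (suc m) k
    ≡⟨ cong (_- Q (suc m) k) (Q-suc (suc m) k (suc j) (trans (+-suc k j) eq) (m≤n⇒m≤1+n k≤m)) ⟩
      + c * + k * Q (suc m) (k ∸ 1) + + c * + suc j * Q (suc m) k - Q (suc m) k
    ≡⟨ cong (λ x → x + + c * + suc j * Q (suc m) k - Q (suc m) k) (Q-unfold m k) ⟩
      + c * + k * (Q (suc m) k + Q m (k ∸ 1)) + + c * + suc j * Q (suc m) k - Q (suc m) k
    ≡⟨ +-cancel-difference (regroup (+ c) (+ k) (+ j) (Q (suc m) k) (Q m (k ∸ 1)) (Q m k))
                           (sym (Q-suc m k j (suc-injective eq) k≤m)) ⟩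
      + c * + suc k * Q (suc m) k + + c * + j * (Q (suc m) k - Q m k)
    ∎
    where
    regroup : ∀ c k j a b e → c * k * (a + b) + c * (+ 1 + j) * a - a
                           ≡ c * (+ 1 + k) * a + c * j * (a - e) + (c * k * b + c * j * e - a)
    regroup = solve-∀

  Q-diagonal-suc : ∀ n → Q (suc n) (suc n) ≡ + suc n * + c * Q n n + ε (suc n)
  Q-diagonal-suc zero    = base (+ c)
    where
    base : ∀ c → + 1 * (c * + 1) - + 1 ≡ + 1 * c * (+ 1 * + 1) + -1ℤ * + 1
    base = solve-∀
  Q-diagonal-suc (suc n) = begin
      Q (suc (suc n)) (suc n) - Q (suc n) (suc n)
    ≡⟨ cong (_- Q (suc n) (suc n)) (Q-suc (suc n) (suc n) 1 (+-comm (suc n) 1) ≤-refl) ⟩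
      + c * + suc n * Q (suc n) n + + c * + 1 * Q (suc n) (suc n) - Q (suc n) (suc n)
    ≡⟨ cong (λ x → x + + c * + 1 * Q (suc n) (suc n) - Q (suc n) (suc n)) (Q-unfold n (suc n)) ⟩
      + c * + suc n * (Q (suc n) (suc n) + Q n n) + + c * + 1 * Q (suc n) (suc n) - Q (suc n) (suc n)
    ≡⟨ +-cancel-difference (regroup (+ c) (+ n) (Q (suc n) (suc n)) (Q n n) (ε (suc n)))
                           (sym (Q-diagonal-suc n)) ⟩
      + suc (suc n) * + c * Q (suc n) (suc n) + ε (suc (suc n))
    ∎
    where
    regroup : ∀ c n d₁ d₀ e → c * (+ 1 + n) * (d₁ + d₀) + c * + 1 * d₁ - d₁
                           ≡ (+ 1 + (+ 1 + n)) * c * d₁ + -1ℤ * e + ((+ 1 + n) * c * d₀ + e - d₁)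
    regroup = solve-∀

  Q-suc-if : ∀ m k j (e : Bool) → k ℕ.+ j ≡ suc m → k ≤ m →
    + c * (+ k * Q m (k ∸ 1) + + j * Q m k) - (if e then Q m k else 0ℤ) ≡ Q (suc m) ((if e then 1 else 0) ℕ.+ k)
  Q-suc-if m k j true  k+j≡ k≤m =
    trans (distrib (+ c) (+ k) (+ j) (Q m (k ∸ 1)) (Q m k)) (cong (_- Q m k) (sym (Q-suc m k j k+j≡ k≤m)))
    where
    distrib : ∀ c k j a b → c * (k * a + j * b) - b ≡ c * k * a + c * j * b - b
    distrib = solve-∀
  Q-suc-if m k j false k+j≡ k≤m =
    trans (distrib (+ c) (+ k) (+ j) (Q m (k ∸ 1)) (Q m k)) (sym (Q-suc m k j k+j≡ k≤m))
    where
    distrib : ∀ c k j a b → c * (k * a + j * b) - 0ℤ ≡ c * k * a + c * j * b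
    distrib = solve-∀

module Colours where

  open import Data.Bool using (Bool; true; false; _∧_; if_then_else_)
  open import Data.Fin using (Fin; toℕ)
  open import Data.Integer using (ℤ; +_; 0ℤ; 1ℤ; -1ℤ; _+_; _-_; _*_)
  open import Data.Integer.Properties using (*-identityˡ)
  open import Data.Integer.Tactic.RingSolver using (solve-∀)
  open import Data.List using (allFin)
  open import Data.Nat as ℕ using (ℕ; suc; _≡ᵇ_)
  open import Data.Vec using (Vec; []; _∷_)
  open import Function using (_∘_)
  open import Relation.Binary.PropositionalEquality
  open ≡-Reasoning
  open Sums
  open Signs

  module _ {c : ℕ} (w : Fin c → ℤ) where

    ∏-weights : ∀ {m} → Vec (Fin c) m → ℤ
    ∏-weights []      = 1ℤ
    ∏-weights (x ∷ t) = w x * ∏-weights t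

  colourFactor : ∀ c → (Fin c → ℤ) → Bool → ℤ
  colourFactor c w b = ∑[ x ← allFin c ] (if b ∧ (toℕ x ≡ᵇ 0) then 0ℤ else w x)

  matchWeight : ℕ → Bool → ℤ
  matchWeight c b = if b then + c - 1ℤ else + c

  ∏-weights-const-1 : ∀ {c m} (t : Vec (Fin c) m) → ∏-weights (λ _ → 1ℤ) t ≡ 1ℤ
  ∏-weights-const-1 []      = refl
  ∏-weights-const-1 (x ∷ t) = trans (*-identityˡ _) (∏-weights-const-1 t)

  colourFactor-const-1 : ∀ k b → colourFactor (suc k) (λ _ → 1ℤ) b ≡ matchWeight (suc k) b
  colourFactor-const-1 k false = ∑-const-1-allFin (suc k)
  colourFactor-const-1 k true  = begin
    colourFactor (suc k) (λ _ → 1ℤ) true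
      ≡⟨ ∑-allFin-suc {k} (λ x → if toℕ x ≡ᵇ 0 then 0ℤ else 1ℤ) ⟩
    0ℤ + ∑ (allFin k) (λ _ → 1ℤ)
      ≡⟨ cong (_+_ 0ℤ) (∑-const-1-allFin k) ⟩
    0ℤ + + k
      ≡⟨ shift (+ k) ⟩
    + suc k - 1ℤ ∎
    where
    shift : ∀ x → 0ℤ + x ≡ 1ℤ + x - 1ℤ
    shift = solve-∀

  -- Colour 0 has sign +1, so dropping it from the vanishing alternating sum leaves −1.
  colourFactor-sign : ∀ q b → colourFactor (suc q ℕ.* 2) (ε ∘ toℕ) b ≡ (if b then -1ℤ else 0ℤ)
  colourFactor-sign q false = ∑-alternating (suc q) ε ε-suc
  colourFactor-sign q true  = begin
    colourFactor (suc q ℕ.* 2) (ε ∘ toℕ) true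
      ≡⟨ ∑-allFin-suc {suc (q ℕ.* 2)} (λ x → if toℕ x ≡ᵇ 0 then 0ℤ else ε (toℕ x)) ⟩
    0ℤ + nonzeroColours
      ≡⟨ shift nonzeroColours allColours≡0 ⟩
    -1ℤ ∎
    where
    nonzeroColours : ℤ
    nonzeroColours = ∑[ i ← allFin (suc (q ℕ.* 2)) ] ε (suc (toℕ i))
    allColours≡0 : 1ℤ + nonzeroColours ≡ 0ℤ
    allColours≡0 = trans (sym (∑-allFin-suc {suc (q ℕ.* 2)} (ε ∘ toℕ))) (∑-alternating (suc q) ε ε-suc)
    shift : ∀ x → 1ℤ + x ≡ 0ℤ → 0ℤ + x ≡ -1ℤ
    shift x eq = trans (0+x≡1+x-1 x) (cong (_- 1ℤ) eq)
      where
      0+x≡1+x-1 : ∀ x → 0ℤ + x ≡ 1ℤ + x - 1ℤ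
      0+x≡1+x-1 = solve-∀

module Matches {A : Set} (_≟_ : DecidableEquality A) where

  open import Data.Bool using (Bool; true; false; not; _∧_; _∨_; if_then_else_)
  open import Data.Fin using (Fin; zero; suc; toℕ)
  open import Data.Integer using (ℤ; +_; 0ℤ; 1ℤ; _+_; _-_; _*_; _^_)
  open import Data.Integer.Properties using (+-identityʳ; *-zeroˡ; *-zeroʳ)
  open import Data.Integer.Tactic.RingSolver using (solve-∀)
  open import Data.List using (List; []; _∷_; length; allFin; tabulate)
  open import Data.List.Properties using (length-tabulate)
  open import Data.Nat as ℕ using (ℕ; zero; suc; _∸_; _≡ᵇ_)
  import Data.Nat.Properties as ℕ
  open import Data.Vec as Vec using (Vec; []; _∷_; toList)
  open import Function using (_∘_)
  open import Relation.Binary.PropositionalEquality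
  open ≡-Reasoning
  open import Defs using (allVecs; count)
  open Sums
  open Membership _≟_
  open Words _≟_
  open Colours

  ∏-matches : (Bool → ℤ) → ∀ {m} → Vec A m → (Fin m → A) → ℤ
  ∏-matches φ []      r = 1ℤ
  ∏-matches φ (s ∷ σ) r = φ (s == r zero) * ∏-matches φ σ (r ∘ suc)

  ∏-matches-cong : ∀ {φ ψ : Bool → ℤ} → (∀ b → φ b ≡ ψ b) →
    ∀ {m} (σ : Vec A m) r → ∏-matches φ σ r ≡ ∏-matches ψ σ r
  ∏-matches-cong φ≗ψ []      r = refl
  ∏-matches-cong φ≗ψ (s ∷ σ) r = cong₂ _*_ (φ≗ψ _) (∏-matches-cong φ≗ψ σ (r ∘ suc))

  -- hasFixedPointᵇ is the case r = id; a general r is needed for induction over the positions.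
  hasUncolouredMatchᵇ : ∀ {c m} → Vec A m → Vec (Fin c) m → (Fin m → A) → Bool
  hasUncolouredMatchᵇ []      []      r = false
  hasUncolouredMatchᵇ (s ∷ σ) (x ∷ t) r =
    ((s == r zero) ∧ (toℕ x ≡ᵇ 0)) ∨ hasUncolouredMatchᵇ σ t (r ∘ suc)

  module _ (c : ℕ) (w : Fin c → ℤ) where

    ∑-colourings : ∀ {m} (σ : Vec A m) r →
      ∑[ t ← allVecs (allFin c) m ] (if hasUncolouredMatchᵇ σ t r then 0ℤ else ∏-weights w t)
      ≡ ∏-matches (colourFactor c w) σ r
    ∑-colourings []      r = refl
    ∑-colourings {suc m} (s ∷ σ) r = begin
        ∑[ t ← allVecs (allFin c) (suc m) ] (if hasUncolouredMatchᵇ (s ∷ σ) t r then 0ℤ else ∏-weights w t)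
      ≡⟨ ∑-allVecs-suc (allFin c) m _ ⟩
        ∑[ x ← allFin c ] ∑[ t ← allVecs (allFin c) m ] (if b x ∨ rest t then 0ℤ else w x * ∏-weights w t)
      ≡⟨ ∑-cong (allFin c) (λ x → ∑-cong (allVecs (allFin c) m) (λ t → split (b x) (rest t))) ⟩
        ∑[ x ← allFin c ] ∑[ t ← allVecs (allFin c) m ] (f x * g t)
      ≡⟨ ∑-cong (allFin c) (λ x → ∑-distribˡ-* (allVecs (allFin c) m) (f x) g) ⟩
        ∑[ x ← allFin c ] (f x * ∑ (allVecs (allFin c) m) g)
      ≡⟨ ∑-distribʳ-* (allFin c) _ f ⟩
        colourFactor c w (s == r zero) * ∑ (allVecs (allFin c) m) g
      ≡⟨ cong (colourFactor c w (s == r zero) *_) (∑-colourings σ (r ∘ suc)) ⟩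
        ∏-matches (colourFactor c w) (s ∷ σ) r
      ∎
      where
      b : Fin c → Bool
      b x = (s == r zero) ∧ (toℕ x ≡ᵇ 0)
      rest : Vec (Fin c) m → Bool
      rest t = hasUncolouredMatchᵇ σ t (r ∘ suc)
      f : Fin c → ℤ
      f x = if b x then 0ℤ else w x
      g : Vec (Fin c) m → ℤ
      g t = if rest t then 0ℤ else ∏-weights w t
      split : ∀ b₁ b₂ {u v} →
        (if b₁ ∨ b₂ then 0ℤ else u * v) ≡ (if b₁ then 0ℤ else u) * (if b₂ then 0ℤ else v)
      split true  b₂    {u} {v} = sym (*-zeroˡ (if b₂ then 0ℤ else v))
      split false true  {u} {v} = sym (*-zeroʳ u)
      split false false = refl

  ∑-∏-matches-indicator : ∀ (a : ℤ) {m} xs (r : Fin m → A) (h : Vec A m → ℤ) →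
    uniqueᵇ xs ≡ true → (∀ i → (r i ∈ᵇ xs) ≡ true) →
    ∑[ v ← allVecs xs m ] (h v * ∏-matches (λ b → if b then a else 0ℤ) v r) ≡ h (Vec.tabulate r) * a ^ m
  ∑-∏-matches-indicator a {zero}  xs r h u r∈ = +-identityʳ _
  ∑-∏-matches-indicator a {suc m} xs r h u r∈ = begin
      ∑[ v ← allVecs xs (suc m) ] (h v * ∏-matches δ v r)
    ≡⟨ ∑-allVecs-suc xs m _ ⟩
      ∑[ x ← xs ] ∑[ v ← allVecs xs m ] (h (x ∷ v) * (δ (x == r zero) * ∏-matches δ v (r ∘ suc)))
    ≡⟨ ∑-cong xs first-letter ⟩
      ∑[ x ← xs ] (if x == r zero then a * rest x else 0ℤ)
    ≡⟨ ∑-select xs (λ x → a * rest x) u ⟩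
      (if r zero ∈ᵇ xs then a * rest (r zero) else 0ℤ)
    ≡⟨ cong (if_then a * rest (r zero) else 0ℤ) (r∈ zero) ⟩
      a * rest (r zero)
    ≡⟨ cong (a *_) (∑-∏-matches-indicator a xs (r ∘ suc) (h ∘ (r zero ∷_)) u (r∈ ∘ suc)) ⟩
      a * (h (Vec.tabulate r) * a ^ m)
    ≡⟨ swap a (h (Vec.tabulate r)) (a ^ m) ⟩
      h (Vec.tabulate r) * a ^ suc m
    ∎
    where
    δ : Bool → ℤ
    δ b = if b then a else 0ℤ
    rest : A → ℤ
    rest x = ∑[ v ← allVecs xs m ] (h (x ∷ v) * ∏-matches δ v (r ∘ suc))
    swap : ∀ a b p → a * (b * p) ≡ b * (a * p)
    swap = solve-∀
    first-letter : ∀ x →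
      ∑[ v ← allVecs xs m ] (h (x ∷ v) * (δ (x == r zero) * ∏-matches δ v (r ∘ suc)))
      ≡ (if x == r zero then a * rest x else 0ℤ)
    first-letter x with x == r zero
    ... | true  = trans (∑-cong (allVecs xs m) (λ v → swap (h (x ∷ v)) a _))
                        (∑-distribˡ-* (allVecs xs m) a _)
    ... | false = trans (∑-cong (allVecs xs m) (λ v → h*0*p≡0 (h (x ∷ v)) (∏-matches δ v (r ∘ suc))))
                        (∑-zero (allVecs xs m))
      where
      h*0*p≡0 : ∀ h p → h * (0ℤ * p) ≡ 0ℤ
      h*0*p≡0 = solve-∀

  module _ (c : ℕ) where

    open ArrangementNumbers c

    matchWeight-*-Q : ∀ m k kx (inRows matches : Bool) → (inRows ≡ true → matches ≡ false) →
      kx ℕ.+ (if inRows then 1 else 0) ≡ k →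
      matchWeight c matches * Q m kx
      ≡ + c * (if inRows then Q m (k ∸ 1) else Q m k) - (if matches then Q m k else 0ℤ)
    matchWeight-*-Q m .(kx ℕ.+ 1) kx true  matches excl refl rewrite excl refl | ℕ.m+n∸n≡m kx 1 =
      sym (+-identityʳ _)
    matchWeight-*-Q m .(kx ℕ.+ 0) kx false true  _ refl rewrite ℕ.+-identityʳ kx = c-1* (+ c) (Q m kx)
      where
      c-1* : ∀ c q → (c - 1ℤ) * q ≡ c * q - q
      c-1* = solve-∀
    matchWeight-*-Q m .(kx ℕ.+ 0) kx false false _ refl rewrite ℕ.+-identityʳ kx = sym (+-identityʳ _)

    -- The first letter x of an arrangement of xs against r = r₀ ∷ rows′ contributes
    -- `contribution x`; k counts the letters of xs that own a slot among rows′.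
    module FirstLetter {m} (xs : List A) (r : Fin (suc m) → A)
                       (uxs : uniqueᵇ xs ≡ true) (ur : uniqueᵇ (tabulate r) ≡ true) (len : length xs ≡ suc m)
                       where

      rows′ : List A
      rows′ = tabulate (r ∘ suc)

      k j : ℕ
      k = count (_∈ᵇ rows′) xs
      j = count (not ∘ (_∈ᵇ rows′)) xs

      contribution : A → ℤ
      contribution x = + c * (if x ∈ᵇ rows′ then Q m (k ∸ 1) else Q m k) - (if x == r zero then Q m k else 0ℤ)

      r₀∉rows′ : (r zero ∈ᵇ rows′) ≡ false
      r₀∉rows′ = uniqueᵇ-head (r zero) rows′ ur

      matches⇒∉rows′ : ∀ x → (x ∈ᵇ rows′) ≡ true → (x == r zero) ≡ false
      matches⇒∉rows′ x x∈ with x == r zero in eq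
      ... | false = refl
      ... | true with ==⇒≡ eq
      ...   | refl with trans (sym x∈) r₀∉rows′
      ...     | ()

      length-remove≡m : ∀ {x} → (x ∈ᵇ xs) ≡ true → length (remove x xs) ≡ m
      length-remove≡m x∈ = ℕ.suc-injective (trans (ℕ.+-comm 1 _) (trans (length-remove xs uxs x∈) len))

      weight-*-Q≡contribution : ∀ x → (x ∈ᵇ xs) ≡ true →
        matchWeight c (x == r zero) * Q m (count (_∈ᵇ rows′) (remove x xs)) ≡ contribution x
      weight-*-Q≡contribution x x∈ =
        matchWeight-*-Q m k _ (x ∈ᵇ rows′) (x == r zero) (matches⇒∉rows′ x)
                            (count-remove (_∈ᵇ rows′) xs uxs x∈)

      ∑-contribution : ∑ xs contribution ≡ Q (suc m) (count (_∈ᵇ tabulate r) xs)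
      ∑-contribution = begin
          ∑ xs contribution
        ≡⟨ ∑-distrib-- xs _ _ ⟩
          ∑[ x ← xs ] (+ c * (if x ∈ᵇ rows′ then Q m (k ∸ 1) else Q m k))
            - ∑[ x ← xs ] (if x == r zero then Q m k else 0ℤ)
        ≡⟨ cong₂ _-_ (trans (∑-distribˡ-* xs (+ c) _) (cong (+ c *_) (∑-if (_∈ᵇ rows′) xs _ _)))
                     (∑-select xs (λ _ → Q m k) uxs) ⟩
          + c * (+ k * Q m (k ∸ 1) + + j * Q m k) - (if r zero ∈ᵇ xs then Q m k else 0ℤ)
        ≡⟨ Q-suc-if m k j (r zero ∈ᵇ xs) (trans (count-+-count-not (_∈ᵇ rows′) xs) len) k≤m ⟩
          Q (suc m) ((if r zero ∈ᵇ xs then 1 else 0) ℕ.+ k)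
        ≡⟨ cong (Q (suc m)) (count-==-∨ (_∈ᵇ rows′) xs uxs r₀∉rows′) ⟨
          Q (suc m) (count (_∈ᵇ tabulate r) xs)
        ∎
        where
        k≤m : k ℕ.≤ m
        k≤m = ℕ.≤-trans (pigeonhole rows′ xs uxs) (ℕ.≤-reflexive (length-tabulate (r ∘ suc)))

    ∑-arrangements : ∀ m xs (r : Fin m → A) → uniqueᵇ xs ≡ true → uniqueᵇ (tabulate r) ≡ true →
      length xs ≡ m →
      ∑[ v ← allVecs xs m ] (if uniqueᵇ (toList v) then ∏-matches (matchWeight c) v r else 0ℤ)
      ≡ Q m (count (_∈ᵇ tabulate r) xs)
    ∑-arrangements zero    []  r _   _  refl = refl
    ∑-arrangements (suc m) xs r uxs ur len = begin
        ∑[ v ← allVecs xs (suc m) ] (if uniqueᵇ (toList v) then ∏-matches ω v r else 0ℤ)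
      ≡⟨ ∑-uniqueWords-suc m xs _ ⟩
        ∑[ x ← xs ] ∑[ w ← allVecs (remove x xs) m ]
          (if uniqueᵇ (toList w) then ω (x == r zero) * ∏-matches ω w (r ∘ suc) else 0ℤ)
      ≡⟨ ∑-cong xs (λ x → trans
           (∑-cong (allVecs (remove x xs) m) (λ w →
              if0-*ˡ (uniqueᵇ (toList w)) (ω (x == r zero)) (∏-matches ω w (r ∘ suc))))
           (∑-distribˡ-* (allVecs (remove x xs) m) (ω (x == r zero)) _)) ⟩
        ∑[ x ← xs ] (ω (x == r zero) * ∑[ w ← allVecs (remove x xs) m ]
                                         (if uniqueᵇ (toList w) then ∏-matches ω w (r ∘ suc) else 0ℤ))
      ≡⟨ ∑-cong-∈ᵇ xs (λ x x∈ →
           trans (cong (ω (x == r zero) *_)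
                       (∑-arrangements m (remove x xs) (r ∘ suc) (uniqueᵇ-remove xs uxs)
                                       (uniqueᵇ-tail (r zero) rows′ ur) (length-remove≡m x∈)))
                 (weight-*-Q≡contribution x x∈)) ⟩
        ∑ xs contribution
      ≡⟨ ∑-contribution ⟩
        Q (suc m) (count (_∈ᵇ tabulate r) xs)
      ∎
      where
      ω : Bool → ℤ
      ω = matchWeight c
      open FirstLetter xs r uxs ur len

module Rationals where

  open import Data.Integer as ℤ using (ℤ; +_)
  open import Data.Integer.Tactic.RingSolver using (solve-∀)
  open import Data.List using ([]; _∷_; map; _++_)
  open import Data.Nat as ℕ using (ℕ; suc; _!)
  open import Data.Nat.Properties using (_!≢0)
  open import Data.Rational using (ℚ; _/_; 1ℚ; _+_; _*_; toℚᵘ)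
  open import Data.Rational.Properties
    using (toℚᵘ-injective; toℚᵘ-fromℚᵘ; toℚᵘ-homo-+; toℚᵘ-homo-*; +-identityˡ; +-assoc;
           *-distribˡ-+; *-zeroʳ)
  open import Data.Rational.Unnormalised as ℚᵘ using (mkℚᵘ; *≡*)
  open import Data.Rational.Unnormalised.Properties using (≃-trans; ≃-sym; +-cong; *-cong)
  open import Relation.Binary.PropositionalEquality
  open import Defs using (sumℚ)

  ι : ℤ → ℚ
  ι i = i / 1

  -- Identities are transported to ℚᵘ, where i / suc d becomes mkℚᵘ i d, and checked there by
  -- cross-multiplication.
  private
    /suc≃mkℚᵘ : (i : ℤ) (d : ℕ) → toℚᵘ (i / suc d) ℚᵘ.≃ mkℚᵘ i d
    /suc≃mkℚᵘ i d = toℚᵘ-fromℚᵘ (mkℚᵘ i d)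

  ι-homo-+ : ∀ i j → ι (i ℤ.+ j) ≡ ι i + ι j
  ι-homo-+ i j = toℚᵘ-injective (≃-trans (/suc≃mkℚᵘ (i ℤ.+ j) 0)
    (≃-sym (≃-trans (toℚᵘ-homo-+ (ι i) (ι j))
                    (≃-trans (+-cong (/suc≃mkℚᵘ i 0) (/suc≃mkℚᵘ j 0)) (*≡* (cross i j))))))
    where
    cross : ∀ i j → (i ℤ.* + 1 ℤ.+ j ℤ.* + 1) ℤ.* + 1 ≡ (i ℤ.+ j) ℤ.* + 1
    cross = solve-∀

  ι-homo-* : ∀ i j → ι (i ℤ.* j) ≡ ι i * ι j
  ι-homo-* i j = toℚᵘ-injective (≃-trans (/suc≃mkℚᵘ (i ℤ.* j) 0)
    (≃-sym (≃-trans (toℚᵘ-homo-* (ι i) (ι j))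
                    (≃-trans (*-cong (/suc≃mkℚᵘ i 0) (/suc≃mkℚᵘ j 0)) (*≡* refl)))))

  /≡ι-*-1/ : (i : ℤ) (d : ℕ) .{{_ : ℕ.NonZero d}} → i / d ≡ ι i * (+ 1 / d)
  /≡ι-*-1/ i (suc d) = toℚᵘ-injective (≃-trans (/suc≃mkℚᵘ i d)
    (≃-sym (≃-trans (toℚᵘ-homo-* (ι i) (+ 1 / suc d))
                    (≃-trans (*-cong (/suc≃mkℚᵘ i 0) (/suc≃mkℚᵘ (+ 1) d)) (*≡* (cross i (+ suc d)))))))
    where
    cross : ∀ i e → (i ℤ.* + 1) ℤ.* e ≡ i ℤ.* (+ 1 ℤ.* e)
    cross = solve-∀

  1/d*ι-d≡1 : (d : ℕ) .{{_ : ℕ.NonZero d}} → (+ 1 / d) * ι (+ d) ≡ 1ℚ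
  1/d*ι-d≡1 (suc d) = toℚᵘ-injective (≃-trans (toℚᵘ-homo-* (+ 1 / suc d) (ι (+ suc d)))
    (≃-trans (*-cong (/suc≃mkℚᵘ (+ 1) d) (/suc≃mkℚᵘ (+ suc d) 0)) (*≡* (cross (+ suc d)))))
    where
    cross : ∀ e → (+ 1 ℤ.* e) ℤ.* + 1 ≡ + 1 ℤ.* (e ℤ.* + 1)
    cross = solve-∀

  sumℚ-++ : ∀ xs ys → sumℚ (xs ++ ys) ≡ sumℚ xs + sumℚ ys
  sumℚ-++ []       ys = sym (+-identityˡ (sumℚ ys))
  sumℚ-++ (x ∷ xs) ys = trans (cong (_+_ x) (sumℚ-++ xs ys)) (sym (+-assoc x (sumℚ xs) (sumℚ ys)))

  sumℚ-distribˡ-* : ∀ {A : Set} (a : ℚ) (f : A → ℚ) xs →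
    sumℚ (map (λ k → a * f k) xs) ≡ a * sumℚ (map f xs)
  sumℚ-distribˡ-* a f []       = sym (*-zeroʳ a)
  sumℚ-distribˡ-* a f (x ∷ xs) =
    trans (cong (_+_ (a * f x)) (sumℚ-distribˡ-* a f xs)) (sym (*-distribˡ-+ a (f x) _))

  1/_! : ℕ → ℚ
  1/ k ! = (+ 1 / k !) {{k !≢0}}

  /!≡ι-*-1/! : ∀ i k → (i / k !) {{k !≢0}} ≡ ι i * 1/ k !
  /!≡ι-*-1/! i k = /≡ι-*-1/ i (k !) {{k !≢0}}

module Formula (c : ℕ) where

  open import Data.Integer as ℤ using (ℤ; +_)
  open import Data.Integer.Properties using (pos-*) renaming (*-identityʳ to *-identityʳ-ℤ)
  open import Data.Integer.Tactic.RingSolver using (solve-∀)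
  open import Data.List using ([]; _∷_; map; upTo; _++_)
  open import Data.List.Properties using (map-++; upTo-∷ʳ; map-cong-local)
  open import Data.List.Relation.Unary.All.Properties using (applyUpTo⁺₁)
  open import Data.Nat as ℕ using (ℕ; zero; suc; _!; _∸_; _≤_)
  open import Data.Nat.Properties using (_!≢0; +-∸-assoc; m+n∸n≡m; <⇒≤)
  open import Data.Rational using (ℚ; _/_; 1ℚ; 0ℚ; _+_; _-_; _*_)
  open import Data.Rational.Properties using (+-identityʳ; *-identityˡ; *-identityʳ; *-assoc)
  open import Data.Product using (_×_; _,_)
  open import Data.Rational.Solver using (module +-*-Solver)
  open import Function using (_∘_)
  open import Relation.Binary.PropositionalEquality
  open ≡-Reasoning
  open import Defs using (formula; sumℚ)
  open Signs
  open ArrangementNumbers c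
  open Rationals

  -- Literally the summand of formula, so that formula c n reduces to (n! / 2) * V n.
  term : ℕ → ℕ → ℚ
  term n k = ((ε k ℤ.* (+ c) ℤ.^ (n ∸ k)) / (k !)) {{k !≢0}}

  V : ℕ → ℚ
  V n = sumℚ (map (term n) (upTo n))

  term-suc : ∀ n k → k ≤ n → term (suc n) k ≡ ι (+ c) * term n k
  term-suc n k k≤n = begin
      term (suc n) k
    ≡⟨ /!≡ι-*-1/! (ε k ℤ.* (+ c) ℤ.^ (suc n ∸ k)) k ⟩
      ι (ε k ℤ.* (+ c) ℤ.^ (suc n ∸ k)) * 1/ k !
    ≡⟨ cong (λ e → ι (ε k ℤ.* (+ c) ℤ.^ e) * 1/ k !) (+-∸-assoc 1 k≤n) ⟩
      ι (ε k ℤ.* (+ c ℤ.* (+ c) ℤ.^ (n ∸ k))) * 1/ k !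
    ≡⟨ cong (_* 1/ k !) (ι-*-swap (ε k) (+ c) ((+ c) ℤ.^ (n ∸ k))) ⟩
      ι (+ c) * ι (ε k ℤ.* (+ c) ℤ.^ (n ∸ k)) * 1/ k !
    ≡⟨ *-assoc (ι (+ c)) _ _ ⟩
      ι (+ c) * (ι (ε k ℤ.* (+ c) ℤ.^ (n ∸ k)) * 1/ k !)
    ≡⟨ cong (ι (+ c) *_) (/!≡ι-*-1/! (ε k ℤ.* (+ c) ℤ.^ (n ∸ k)) k) ⟨
      ι (+ c) * term n k
    ∎
    where
    ι-*-swap : ∀ a b d → ι (a ℤ.* (b ℤ.* d)) ≡ ι b * ι (a ℤ.* d)
    ι-*-swap a b d = trans (cong ι (swap a b d)) (ι-homo-* b (a ℤ.* d))
      where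
      swap : ∀ a b d → a ℤ.* (b ℤ.* d) ≡ b ℤ.* (a ℤ.* d)
      swap = solve-∀

  term-last : ∀ n → term (suc n) n ≡ ι (ε n) * ι (+ c) * 1/ n !
  term-last n = begin
      term (suc n) n
    ≡⟨ /!≡ι-*-1/! (ε n ℤ.* (+ c) ℤ.^ (suc n ∸ n)) n ⟩
      ι (ε n ℤ.* (+ c) ℤ.^ (suc n ∸ n)) * 1/ n !
    ≡⟨ cong (λ e → ι (ε n ℤ.* (+ c) ℤ.^ e) * 1/ n !) (m+n∸n≡m 1 n) ⟩
      ι (ε n ℤ.* (+ c ℤ.* + 1)) * 1/ n !
    ≡⟨ cong (λ x → ι (ε n ℤ.* x) * 1/ n !) (*-identityʳ-ℤ (+ c)) ⟩
      ι (ε n ℤ.* + c) * 1/ n !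
    ≡⟨ cong (_* 1/ n !) (ι-homo-* (ε n) (+ c)) ⟩
      ι (ε n) * ι (+ c) * 1/ n !
    ∎

  V-suc : ∀ n → V (suc n) ≡ ι (+ c) * V n + ι (ε n) * ι (+ c) * 1/ n !
  V-suc n = begin
      sumℚ (map (term (suc n)) (upTo (suc n)))
    ≡⟨ cong (sumℚ ∘ map (term (suc n))) (upTo-∷ʳ n) ⟨
      sumℚ (map (term (suc n)) (upTo n ++ n ∷ []))
    ≡⟨ cong sumℚ (map-++ (term (suc n)) (upTo n) (n ∷ [])) ⟩
      sumℚ (map (term (suc n)) (upTo n) ++ term (suc n) n ∷ [])
    ≡⟨ sumℚ-++ (map (term (suc n)) (upTo n)) _ ⟩
      sumℚ (map (term (suc n)) (upTo n)) + (term (suc n) n + 0ℚ)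
    ≡⟨ cong₂ _+_ (trans (cong sumℚ (map-cong-local (applyUpTo⁺₁ (λ k → k) n
                                       (λ k<n → term-suc n _ (<⇒≤ k<n)))))
                        (sumℚ-distribˡ-* (ι (+ c)) (term n) (upTo n)))
                 (trans (+-identityʳ _) (term-last n)) ⟩
      ι (+ c) * V n + ι (ε n) * ι (+ c) * 1/ n !
    ∎

  factorial-*-V : ∀ n → ι (+ (n !)) * V n ≡ ι (Q n n ℤ.- ε n)
  factorial-*-V zero    = refl
  factorial-*-V (suc n) = begin
      ι (+ (suc n ℕ.* n !)) * V (suc n)
    ≡⟨ cong₂ _*_ (trans (cong ι (pos-* (suc n) (n !))) (ι-homo-* (+ suc n) (+ (n !)))) (V-suc n) ⟩
      ι (+ suc n) * ι (+ (n !)) * (ι (+ c) * V n + ι (ε n) * ι (+ c) * 1/ n !)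
    ≡⟨ solve 6 (λ s f c′ v e i → s :* f :* (c′ :* v :+ e :* c′ :* i)
                              := s :* c′ :* (f :* v :+ e :* (i :* f)))
             refl (ι (+ suc n)) (ι (+ (n !))) (ι (+ c)) (V n) (ι (ε n)) (1/ n !) ⟩
      ι (+ suc n) * ι (+ c) * (ι (+ (n !)) * V n + ι (ε n) * (1/ n ! * ι (+ (n !))))
    ≡⟨ cong₂ (λ x y → ι (+ suc n) * ι (+ c) * (x + ι (ε n) * y))
             (factorial-*-V n) (1/d*ι-d≡1 (n !) {{n !≢0}}) ⟩
      ι (+ suc n) * ι (+ c) * (ι (Q n n ℤ.- ε n) + ι (ε n) * 1ℚ)
    ≡⟨ cong (λ y → ι (+ suc n) * ι (+ c) * (ι (Q n n ℤ.- ε n) + y)) (*-identityʳ (ι (ε n))) ⟩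
      ι (+ suc n) * ι (+ c) * (ι (Q n n ℤ.- ε n) + ι (ε n))
    ≡⟨ trans (ι-homo-* (+ suc n ℤ.* + c) _)
             (cong₂ _*_ (ι-homo-* (+ suc n) (+ c)) (ι-homo-+ (Q n n ℤ.- ε n) (ε n))) ⟨
      ι (+ suc n ℤ.* + c ℤ.* (Q n n ℤ.- ε n ℤ.+ ε n))
    ≡⟨ cong ι (trans (cancel (+ suc n) (+ c) (Q n n) (ε n) (ε (suc n)))
                     (cong (ℤ._- ε (suc n)) (sym (Q-diagonal-suc n)))) ⟩
      ι (Q (suc n) (suc n) ℤ.- ε (suc n))
    ∎
    where
    open +-*-Solver
    cancel : ∀ s c q e e′ → s ℤ.* c ℤ.* (q ℤ.- e ℤ.+ e) ≡ s ℤ.* c ℤ.* q ℤ.+ e′ ℤ.- e′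
    cancel = solve-∀

  formula-as-half : ∀ n m → Q n n ℤ.- ε n ≡ + 2 ℤ.* m → formula c n ≡ ι m
  formula-as-half n m eq = begin
      (+ (n !) / 2) * V n
    ≡⟨ cong (_* V n) (/≡ι-*-1/ (+ (n !)) 2) ⟩
      ι (+ (n !)) * ½ * V n
    ≡⟨ solve 3 (λ f h v → f :* h :* v := h :* (f :* v)) refl (ι (+ (n !))) ½ (V n) ⟩
      ½ * (ι (+ (n !)) * V n)
    ≡⟨ cong (½ *_) (trans (factorial-*-V n) (trans (cong ι eq) (ι-homo-* (+ 2) m))) ⟩
      ½ * (ι (+ 2) * ι m)
    ≡⟨ *-assoc ½ (ι (+ 2)) (ι m) ⟨
      ½ * ι (+ 2) * ι m
    ≡⟨ cong (_* ι m) (1/d*ι-d≡1 2) ⟩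
      1ℚ * ι m
    ≡⟨ *-identityˡ (ι m) ⟩
      ι m
    ∎
    where
    open +-*-Solver
    ½ : ℚ
    ½ = + 1 / 2

  formula-from-sum-and-difference : ∀ n p m → p ℤ.+ m ≡ Q n n → p ℤ.- m ≡ ε n →
    (ι p ≡ formula c n + ι (ε n)) × (ι m ≡ formula c n) × (ι p - ι m ≡ ι (ε n))
  formula-from-sum-and-difference n p m p+m≡Q p-m≡ε = ι-p≡ , ι-m≡ , difference
    where
    Q-ε≡2m : Q n n ℤ.- ε n ≡ + 2 ℤ.* m
    Q-ε≡2m = trans (cong₂ ℤ._-_ (sym p+m≡Q) (sym p-m≡ε)) (twice p m)
      where
      twice : ∀ p m → p ℤ.+ m ℤ.- (p ℤ.- m) ≡ + 2 ℤ.* m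
      twice = solve-∀
    ι-m≡ : ι m ≡ formula c n
    ι-m≡ = sym (formula-as-half n m Q-ε≡2m)
    ι-p≡ : ι p ≡ formula c n + ι (ε n)
    ι-p≡ = begin
      ι p                     ≡⟨ cong ι (trans (shift p m) (cong (ℤ._+_ m) p-m≡ε)) ⟩
      ι (m ℤ.+ ε n)           ≡⟨ ι-homo-+ m (ε n) ⟩
      ι m + ι (ε n)           ≡⟨ cong (_+ ι (ε n)) ι-m≡ ⟩
      formula c n + ι (ε n)   ∎
      where
      shift : ∀ p m → p ≡ m ℤ.+ (p ℤ.- m)
      shift = solve-∀
    difference : ι p - ι m ≡ ι (ε n)
    difference = trans (cong₂ _-_ ι-p≡ ι-m≡)
                       (solve 2 (λ f e → (f :+ e) :- f := e) refl (formula c n) (ι (ε n)))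
      where open +-*-Solver

module ColouredPermutations where

  open import Data.Bool using (Bool; true; false; not; _∧_; _∨_; if_then_else_; T?)
  open import Data.Bool.Properties using (T-≡; if-not)
  open import Data.Fin using (Fin; zero; suc; toℕ)
  open import Data.Fin.Properties using (_≟_; ≡-decSetoid)
  open import Data.Integer using (ℤ; +_; 0ℤ; 1ℤ; -1ℤ; _+_; _-_; -_; _*_)
  open import Data.Integer.Properties using (*-identityˡ; pos-+)
  open import Data.Integer.Tactic.RingSolver using (solve-∀)
  open import Data.List using (List; []; _∷_; map; length; allFin; tabulate; foldr; cartesianProduct)
  open import Data.List.Properties using (length-tabulate)
  import Data.List.Relation.Unary.Unique.DecSetoid as UniqueDS
  open import Data.Nat as ℕ using (ℕ; zero; suc; _≡ᵇ_; _<ᵇ_)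
  open import Data.Nat.ListAction using (sum)
  open import Data.Product using (_×_; _,_; proj₁; proj₂)
  open import Data.Vec as Vec using (Vec; []; _∷_; toList; lookup)
  open import Data.Vec.Properties using (lookup∘tabulate)
  open import Function using (_∘_; id; mk⇔; Equivalence)
  open import Relation.Binary.PropositionalEquality
  open import Relation.Nullary.Decidable using (does-⇔)
  open ≡-Reasoning
  open import Defs
  open Sums
  open Signs
  open Colours

  toList-tabulate : ∀ {B : Set} {n} (f : Fin n → B) → toList (Vec.tabulate f) ≡ tabulate f
  toList-tabulate {n = zero}  f = refl
  toList-tabulate {n = suc n} f = cong (f zero ∷_) (toList-tabulate (f ∘ suc))

  anyᶠ : ∀ {k} → (Fin k → Bool) → Bool
  anyᶠ {zero}  g = false
  anyᶠ {suc k} g = g zero ∨ anyᶠ (g ∘ suc)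

  foldr-∨-tabulate : ∀ {B : Set} {k} (g : B → Bool) (h : Fin k → B) →
    foldr (λ i b → g i ∨ b) false (tabulate h) ≡ anyᶠ (g ∘ h)
  foldr-∨-tabulate {k = zero}  g h = refl
  foldr-∨-tabulate {k = suc k} g h = cong (g (h zero) ∨_) (foldr-∨-tabulate g (h ∘ suc))

  <ᵇ-asym : ∀ a b → ((a <ᵇ b) ∧ (b <ᵇ a)) ≡ false
  <ᵇ-asym zero    zero    = refl
  <ᵇ-asym zero    (suc b) = refl
  <ᵇ-asym (suc a) zero    = refl
  <ᵇ-asym (suc a) (suc b) = <ᵇ-asym a b

  inv-identity : ∀ n → inv (Vec.tabulate {n = n} id) ≡ 0
  inv-identity n = trans (count-cong (cartesianProduct (allFin n) (allFin n)) noInversion)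
                         (count-const-false (cartesianProduct (allFin n) (allFin n)))
    where
    noInversion : ∀ (ij : Fin n × Fin n) →
      ((proj₁ ij <F proj₂ ij) ∧ (lookup (Vec.tabulate id) (proj₂ ij) <F lookup (Vec.tabulate id) (proj₁ ij)))
      ≡ false
    noInversion (i , j) rewrite lookup∘tabulate id i | lookup∘tabulate id j = <ᵇ-asym (toℕ i) (toℕ j)

  ε-col : ∀ {c m} (t : Vec (Fin c) m) → ε (sum (map toℕ (toList t))) ≡ ∏-weights (ε ∘ toℕ) t
  ε-col []      = refl
  ε-col (x ∷ t) = trans (ε-+ (toℕ x) _) (cong (ε (toℕ x) *_) (ε-col t))

  ε-L : ∀ q {n} (σ : Vec (Fin n) n) (t : Vec (Fin (q ℕ.* 2)) n) →
    ε (L (σ , t)) ≡ ε (inv σ) * ∏-weights (ε ∘ toℕ) t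
  ε-L q σ t = begin
    ε (col (σ , t) ℕ.+ q ℕ.* 2 ℕ.* colAsc (σ , t) ℕ.+ inv σ)
      ≡⟨ ε-+ (col (σ , t) ℕ.+ q ℕ.* 2 ℕ.* colAsc (σ , t)) (inv σ) ⟩
    ε (col (σ , t) ℕ.+ q ℕ.* 2 ℕ.* colAsc (σ , t)) * ε (inv σ)
      ≡⟨ cong (_* ε (inv σ)) (ε-+ (col (σ , t)) _) ⟩
    ε (col (σ , t)) * ε (q ℕ.* 2 ℕ.* colAsc (σ , t)) * ε (inv σ)
      ≡⟨ cong₂ (λ x y → x * y * ε (inv σ)) (ε-col t) (ε-*-even q (colAsc (σ , t))) ⟩
    ∏-weights (ε ∘ toℕ) t * 1ℤ * ε (inv σ)
      ≡⟨ rearrange (∏-weights (ε ∘ toℕ) t) (ε (inv σ)) ⟩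
    ε (inv σ) * ∏-weights (ε ∘ toℕ) t ∎
    where
    rearrange : ∀ a b → a * 1ℤ * b ≡ b * a
    rearrange = solve-∀

  module _ {n : ℕ} where

    open Membership (_≟_ {n})
    open Matches (_≟_ {n})

    isPermᵇ≡uniqueᵇ : (σ : Vec (Fin n) n) → isPermᵇ σ ≡ uniqueᵇ (toList σ)
    isPermᵇ≡uniqueᵇ σ = does-⇔
      (mk⇔ (Equivalence.from T-≡ ∘ Equivalence.from (uniqueᵇ⇔AllPairs≢ (toList σ)))
           (Equivalence.to (uniqueᵇ⇔AllPairs≢ (toList σ)) ∘ Equivalence.to T-≡))
      (UniqueDS.unique? (≡-decSetoid n) (toList σ)) (T? (uniqueᵇ (toList σ)))

    anyᶠ-match : ∀ {c m} (σ : Vec (Fin n) m) (t : Vec (Fin c) m) r →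
      anyᶠ (λ i → (lookup σ i == r i) ∧ (toℕ (lookup t i) ≡ᵇ 0)) ≡ hasUncolouredMatchᵇ σ t r
    anyᶠ-match []      []      r = refl
    anyᶠ-match (s ∷ σ) (x ∷ t) r =
      cong (((s == r zero) ∧ (toℕ x ≡ᵇ 0)) ∨_) (anyᶠ-match σ t (r ∘ suc))

    hasFixedPointᵇ≡ : ∀ {c} (σ : Vec (Fin n) n) (t : Vec (Fin c) n) →
      hasFixedPointᵇ (σ , t) ≡ hasUncolouredMatchᵇ σ t id
    hasFixedPointᵇ≡ σ t =
      trans (foldr-∨-tabulate (λ i → (lookup σ i == i) ∧ (toℕ (lookup t i) ≡ᵇ 0)) id)
            (anyᶠ-match σ t id)

    ∑-D : ∀ c (F : ColPerm c n → ℤ) →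
      ∑ (D c n) F
      ≡ ∑[ σ ← allVecs (allFin n) n ]
          (if uniqueᵇ (toList σ)
           then ∑[ t ← allVecs (allFin c) n ] (if hasUncolouredMatchᵇ σ t id then 0ℤ else F (σ , t))
           else 0ℤ)
    ∑-D c F = begin
        ∑ (D c n) F
      ≡⟨ ∑-filterᵇ _ (G c n) F ⟩
        ∑[ π ← G c n ] (if not (hasFixedPointᵇ π) then F π else 0ℤ)
      ≡⟨ ∑-cartesianProduct (Perms n) colourings _ ⟩
        ∑[ σ ← Perms n ] inner σ
      ≡⟨ ∑-filterᵇ isPermᵇ (allVecs (allFin n) n) inner ⟩
        ∑[ σ ← allVecs (allFin n) n ] (if isPermᵇ σ then inner σ else 0ℤ)
      ≡⟨ ∑-cong (allVecs (allFin n) n) (λ σ → cong₂ (if_then_else 0ℤ) (isPermᵇ≡uniqueᵇ σ)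
                                            (∑-cong colourings (noFixedPoint σ))) ⟩
        _ ∎
      where
      colourings : List (Vec (Fin c) n)
      colourings = allVecs (allFin c) n
      inner : Vec (Fin n) n → ℤ
      inner σ = ∑[ t ← colourings ] (if not (hasFixedPointᵇ (σ , t)) then F (σ , t) else 0ℤ)
      noFixedPoint : ∀ σ t → (if not (hasFixedPointᵇ (σ , t)) then F (σ , t) else 0ℤ)
                             ≡ (if hasUncolouredMatchᵇ σ t id then 0ℤ else F (σ , t))
      noFixedPoint σ t = trans (if-not (hasFixedPointᵇ (σ , t)))
                               (cong (if_then 0ℤ else F (σ , t)) (hasFixedPointᵇ≡ σ t))

    uniqueᵇ-allFin : uniqueᵇ (allFin n) ≡ true
    uniqueᵇ-allFin = uniqueᵇ-tabulate id id

    count-∈ᵇ-allFin : ∀ xs → count (_∈ᵇ allFin n) xs ≡ length xs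
    count-∈ᵇ-allFin xs = trans (count-cong xs (∈ᵇ-tabulate id)) (count-const-true xs)

    ∑-colourings-1 : ∀ k (σ : Vec (Fin n) n) →
      ∑[ t ← allVecs (allFin (suc k)) n ] (if hasUncolouredMatchᵇ σ t id then 0ℤ else 1ℤ)
      ≡ ∏-matches (matchWeight (suc k)) σ id
    ∑-colourings-1 k σ = begin
        ∑[ t ← allVecs (allFin (suc k)) n ] (if hasUncolouredMatchᵇ σ t id then 0ℤ else 1ℤ)
      ≡⟨ ∑-cong (allVecs (allFin (suc k)) n) (λ t →
           cong (if hasUncolouredMatchᵇ σ t id then 0ℤ else_) (sym (∏-weights-const-1 t))) ⟩
        ∑[ t ← allVecs (allFin (suc k)) n ]
          (if hasUncolouredMatchᵇ σ t id then 0ℤ else ∏-weights (λ _ → 1ℤ) t)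
      ≡⟨ ∑-colourings (suc k) (λ _ → 1ℤ) σ id ⟩
        ∏-matches (colourFactor (suc k) (λ _ → 1ℤ)) σ id
      ≡⟨ ∏-matches-cong (colourFactor-const-1 k) σ id ⟩
        ∏-matches (matchWeight (suc k)) σ id
      ∎

    ∑-colourings-ε∘L : ∀ q (σ : Vec (Fin n) n) →
      ∑[ t ← allVecs (allFin (suc q ℕ.* 2)) n ] (if hasUncolouredMatchᵇ σ t id then 0ℤ else ε (L (σ , t)))
      ≡ ε (inv σ) * ∏-matches (λ b → if b then -1ℤ else 0ℤ) σ id
    ∑-colourings-ε∘L q σ = begin
        ∑[ t ← colourings ] (if fixed t then 0ℤ else ε (L (σ , t)))
      ≡⟨ ∑-cong colourings (λ t → trans (cong (if fixed t then 0ℤ else_) (ε-L (suc q) σ t))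
                                         (else0-*ˡ (fixed t) (ε (inv σ)) (∏-weights (ε ∘ toℕ) t))) ⟩
        ∑[ t ← colourings ] (ε (inv σ) * (if fixed t then 0ℤ else ∏-weights (ε ∘ toℕ) t))
      ≡⟨ ∑-distribˡ-* colourings (ε (inv σ)) _ ⟩
        ε (inv σ) * ∑[ t ← colourings ] (if fixed t then 0ℤ else ∏-weights (ε ∘ toℕ) t)
      ≡⟨ cong (ε (inv σ) *_) (∑-colourings (suc q ℕ.* 2) (ε ∘ toℕ) σ id) ⟩
        ε (inv σ) * ∏-matches (colourFactor (suc q ℕ.* 2) (ε ∘ toℕ)) σ id
      ≡⟨ cong (ε (inv σ) *_) (∏-matches-cong (colourFactor-sign q) σ id) ⟩
        ε (inv σ) * ∏-matches (λ b → if b then -1ℤ else 0ℤ) σ id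
      ∎
      where
      colourings : List (Vec (Fin (suc q ℕ.* 2)) n)
      colourings = allVecs (allFin (suc q ℕ.* 2)) n
      fixed : Vec (Fin (suc q ℕ.* 2)) n → Bool
      fixed t = hasUncolouredMatchᵇ σ t id

    ∑-D-const-1 : ∀ k → ∑ (D (suc k) n) (λ _ → 1ℤ) ≡ ArrangementNumbers.Q (suc k) n n
    ∑-D-const-1 k = begin
        ∑ (D (suc k) n) (λ _ → 1ℤ)
      ≡⟨ ∑-D (suc k) (λ _ → 1ℤ) ⟩
        ∑[ σ ← allVecs (allFin n) n ] (if uniqueᵇ (toList σ) then _ else 0ℤ)
      ≡⟨ ∑-cong (allVecs (allFin n) n) (λ σ →
           cong (if uniqueᵇ (toList σ) then_else 0ℤ) (∑-colourings-1 k σ)) ⟩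
        ∑[ σ ← allVecs (allFin n) n ]
          (if uniqueᵇ (toList σ) then ∏-matches (matchWeight (suc k)) σ id else 0ℤ)
      ≡⟨ ∑-arrangements (suc k) n (allFin n) id uniqueᵇ-allFin uniqueᵇ-allFin (length-tabulate {n = n} id) ⟩
        Q n (count (_∈ᵇ allFin n) (allFin n))
      ≡⟨ cong (Q n) (trans (count-∈ᵇ-allFin (allFin n)) (length-tabulate {n = n} id)) ⟩
        Q n n
      ∎
      where open ArrangementNumbers (suc k)

    ∑-D-sign : ∀ q → ∑ (D (suc q ℕ.* 2) n) (λ π → ε (L π)) ≡ ε n
    ∑-D-sign q = begin
        ∑ (D (suc q ℕ.* 2) n) (λ π → ε (L π))
      ≡⟨ ∑-D (suc q ℕ.* 2) (λ π → ε (L π)) ⟩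
        ∑[ σ ← allVecs (allFin n) n ] (if uniqueᵇ (toList σ) then _ else 0ℤ)
      ≡⟨ ∑-cong (allVecs (allFin n) n) (λ σ →
           trans (cong (if uniqueᵇ (toList σ) then_else 0ℤ) (∑-colourings-ε∘L q σ))
                 (if0-*ʳ (uniqueᵇ (toList σ)) (ε (inv σ)) _)) ⟩
        ∑[ σ ← allVecs (allFin n) n ] (sign σ * ∏-matches (λ b → if b then -1ℤ else 0ℤ) σ id)
      ≡⟨ ∑-∏-matches-indicator -1ℤ (allFin n) id sign uniqueᵇ-allFin (∈ᵇ-tabulate id) ⟩
        sign (Vec.tabulate id) * ε n
      ≡⟨ cong (_* ε n) sign-identity ⟩
        1ℤ * ε n
      ≡⟨ *-identityˡ (ε n) ⟩
        ε n
      ∎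
      where
      sign : Vec (Fin n) n → ℤ
      sign σ = if uniqueᵇ (toList σ) then ε (inv σ) else 0ℤ
      sign-identity : sign (Vec.tabulate id) ≡ 1ℤ
      sign-identity rewrite toList-tabulate {n = n} id | uniqueᵇ-allFin | inv-identity n = refl

  dPlus+dMinus≡Q : ∀ k n → + dPlus (suc k) n + + dMinus (suc k) n ≡ ArrangementNumbers.Q (suc k) n n
  dPlus+dMinus≡Q k n = begin
    + dPlus (suc k) n + + dMinus (suc k) n
      ≡⟨ pos-+ (dPlus (suc k) n) (dMinus (suc k) n) ⟨
    + (dPlus (suc k) n ℕ.+ dMinus (suc k) n)
      ≡⟨ cong +_ (count-+-count-not (isEvenᵇ ∘ L) (D (suc k) n)) ⟩
    + length (D (suc k) n)
      ≡⟨ ∑-const-1 (D (suc k) n) ⟨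
    ∑ (D (suc k) n) (λ _ → 1ℤ)
      ≡⟨ ∑-D-const-1 {n} k ⟩
    ArrangementNumbers.Q (suc k) n n ∎

  dPlus-dMinus≡ε : ∀ q n → + dPlus (suc q ℕ.* 2) n - + dMinus (suc q ℕ.* 2) n ≡ ε n
  dPlus-dMinus≡ε q n = trans (count-even-−-count-odd L (D (suc q ℕ.* 2) n)) (∑-D-sign {n} q)

open import Data.Integer using (+_)
open import Data.Nat as ℕ using (suc; zero; _≤_)
open import Data.Nat.Divisibility using (_∣_; divides)
open import Data.Product using (_×_)
open import Data.Rational using (_+_; _-_)
open import Relation.Binary.PropositionalEquality using (_≡_; refl)
open import Defs
open ColouredPermutations

mainTheorem8 : (c : ℕ) → 1 ≤ c → 2 ∣ c → (n : ℕ) → 1 ≤ n →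
    (toℚ (dPlus c n) ≡ formula c n + signℚ n)
    × (toℚ (dMinus c n) ≡ formula c n)
    × (toℚ (dPlus c n) - toℚ (dMinus c n) ≡ signℚ n)
mainTheorem8 .0 () (divides zero refl) n _
mainTheorem8 c _ (divides (suc q) refl) n _ =
  Formula.formula-from-sum-and-difference c n (+ dPlus c n) (+ dMinus c n)
    (dPlus+dMinus≡Q (suc (q ℕ.* 2)) n) (dPlus-dMinus≡ε q n)
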